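{- $\tilde J_{k,k+1}(a;x;q)=\tilde J_{k,k-1}(a;x;q)$.
   Context: Fix an integer $k\ge2$. Notation: $(a;q)_n=\prod_{m=0}^{n-1}(1-aq^m)$, $(a;q)_\infty=\prod_{m\ge0}(1-aq^m)$. For integers $i$ let $\tilde H_{k,i}(a;x;q)=\sum_{n\ge0}\dfrac{(-a)^nq^{kn^2-\binom n2+n-in}x^{(k-1)n}(1-x^iq^{2ni})(-x;q)_n(-1/a;q)_n(-axq^{n+1};q)_\infty}{(q^2;q^2)_n(xq^n;q)_\infty}$ and $\tilde J_{k,i}(a;x;q)=\tilde H_{k,i}(a;xq;q)+axq\,\tilde H_{k,i-1}(a;xq;q)$. -}

module Defs where

open import Data.Nat using (ℕ; zero; suc; _≤ᵇ_; _∸_) renaming (_+_ to _+ℕ_; _*_ to _*ℕ_)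
open import Data.Nat.Combinatorics using (_C_)
open import Data.Integer using (ℤ; 0ℤ; 1ℤ; -1ℤ) renaming (_+_ to _+ℤ_; _*_ to _*ℤ_; -_ to -ℤ_)
open import Data.Bool using (if_then_else_)
open import Data.Nat using (_≡ᵇ_)

-- Formal power series in ℤ[[a, x, q]].
-- A series is its coefficient function: f d e l is the coefficient of
-- a^d x^e q^l.

Series : Set
Series = ℕ → ℕ → ℕ → ℤ

Σ≤ : ℕ → (ℕ → ℤ) → ℤ
Σ≤ zero    f = f 0
Σ≤ (suc n) f = Σ≤ n f +ℤ f (suc n)

0S : Series
0S _ _ _ = 0ℤ

mono : ℕ → ℕ → ℕ → Series
mono d e l d' e' l' =
  if (d ≡ᵇ d') then (if (e ≡ᵇ e') then (if (l ≡ᵇ l') then 1ℤ else 0ℤ) else 0ℤ) else 0ℤ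

1S : Series
1S = mono 0 0 0

aS xS qS : Series
aS = mono 1 0 0
xS = mono 0 1 0
qS = mono 0 0 1

infixl 6 _+S_ _-S_
infixl 7 _*S_

_+S_ : Series → Series → Series
(f +S g) d e l = f d e l +ℤ g d e l

-S_ : Series → Series
(-S f) d e l = -ℤ (f d e l)

_-S_ : Series → Series → Series
f -S g = f +S (-S g)

_*S_ : Series → Series → Series
(f *S g) d e l =
  Σ≤ d λ d₁ → Σ≤ e λ e₁ → Σ≤ l λ l₁ →
    f d₁ e₁ l₁ *ℤ g (d ∸ d₁) (e ∸ e₁) (l ∸ l₁)

_^S_ : Series → ℕ → Series
f ^S zero    = 1S
f ^S (suc n) = f *S (f ^S n)

Π< : ℕ → (ℕ → Series) → Series
Π< zero    F = 1S
Π< (suc n) F = Π< n F *S F n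

-- 1/(1 - g) = Σ_t g^t, for g without constant term (every monomial of g
-- has x-degree or q-degree ≥ 1); then g^t only contributes to
-- coefficients of total (x,q)-degree ≥ t, so the truncation is exact.
geomInv : Series → Series
geomInv g d e l = Σ≤ (e +ℕ l) λ t → (g ^S t) d e l

poch : Series → Series → ℕ → Series
poch c Q n = Π< n λ m → 1S -S c *S (Q ^S m)

-- (c;q)_∞ = Π_{m ≥ 0} (1 - c q^m).  Factor m is ≡ 1 mod q^m, so the
-- coefficient of q^l only depends on the factors m ≤ l (exact).
pochInf : Series → Series
pochInf c d e l = poch c qS (suc l) d e l

-- 1/(c;q)_∞ = Π_{m ≥ 0} 1/(1 - c q^m), for c without constant term;
-- again factor m is ≡ 1 mod q^m, so this truncation is exact.
invPochInf : Series → Series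
invPochInf c d e l = Π< (suc l) (λ m → geomInv (c *S (qS ^S m))) d e l

invPochQ2 : ℕ → Series
invPochQ2 n = Π< n λ m → geomInv (qS ^S (2 +ℕ 2 *ℕ m))

substXq : Series → Series
substXq f d e l = if (e ≤ᵇ l) then f d e (l ∸ e) else 0ℤ

-- (-a)^n (-1/a;q)_n = Π_{m<n} (-a - q^m), a polynomial in a, q.
aPart : ℕ → Series
aPart n = Π< n λ m → -S aS -S (qS ^S m)

-- q-exponent  k n² - C(n,2) + n - i n  (nonnegative, and computed exactly
-- by truncated subtraction, whenever i ≤ k + 1, which covers every use).
qExp : ℕ → ℕ → ℕ → ℕ
qExp k i n = (k *ℕ n *ℕ n +ℕ n) ∸ (n C 2 +ℕ i *ℕ n)

Hterm : ℕ → ℕ → ℕ → Series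
Hterm k i n =
  aPart n *S mono 0 ((k ∸ 1) *ℕ n) (qExp k i n)
    *S (1S -S mono 0 i (2 *ℕ n *ℕ i))
    *S poch (-S xS) qS n
    *S pochInf (-S aS *S xS *S (qS ^S suc n))
    *S invPochQ2 n
    *S invPochInf (xS *S (qS ^S n))

-- H̃_{k,i} = Σ_{n ≥ 0} Hterm k i n.  For k ≥ 2 the n-th summand has
-- x-degree ≥ (k-1) n ≥ n, so the coefficient of x^e only involves n ≤ e.
H̃ : ℕ → ℕ → Series
H̃ k i d e l = Σ≤ e (λ n → Hterm k i n d e l)

J̃ : ℕ → ℕ → Series
J̃ k i = substXq (H̃ k i) +S mono 1 1 1 *S substXq (H̃ k (i ∸ 1))

{-# OPTIONS --safe #-}
-- Let k = j + 2 and let Δ n be the n-th summand of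
-- (H̃_{k,k+1} + axH̃_{k,k}) - (H̃_{k,k-1} + axH̃_{k,k-2}).  A ring computation shows
-- Δ n = W n - W (n+1) for an explicit W n carrying the factor (1 - q^{2n}), once the
-- factors of the summands are related through
--   (-axq^{n+1};q)_∞ = (1 + axq^{n+1}) (-axq^{n+2};q)_∞,
--   (1 - xq^n) / (xq^n;q)_∞ = 1 / (xq^{n+1};q)_∞,
--   (1 - q^{2n+2}) / (q²;q²)_{n+1} = 1 / (q²;q²)_n.
-- As W 0 = 0 and W n has x-degree at least n, the coefficient of x^e of the difference
-- is that of W 0 - W (e+1), namely 0.  Finally J̃_{k,i} is H̃_{k,i} + axH̃_{k,i-1}
-- under x ↦ xq.  Series are handled as ℤ[[q]][[x]][[a]], the power series ring
-- construction iterated three times, so that the ring solver can do the algebra.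
module Submission where

open import Level using (0ℓ)
open import Algebra.Bundles using (CommutativeRing)
open import Algebra.Structures using (IsCommutativeRing)
import Algebra.Properties.CommutativeSemigroup as CommSemigroupProperties
import Algebra.Properties.Group as GroupProperties
open import Algebra.Solver.Ring.AlmostCommutativeRing
  using (fromCommutativeRing; _-Raw-AlmostCommutative⟶_)
import Algebra.Solver.Ring as RingSolver
open import Data.Bool using (true; false; T)
open import Data.Empty using (⊥-elim)
open import Data.Integer using (ℤ; 0ℤ; 1ℤ; +_; -[1+_])
  renaming (_+_ to _+ℤ_; _*_ to _*ℤ_; -_ to -ℤ_)
import Data.Integer.Properties as ℤ
open import Data.Maybe using (Maybe; just; nothing)
open import Data.Nat using (ℕ; zero; suc; _∸_; _≤_; _<_; z≤n; s≤s; _≤ᵇ_; _≡ᵇ_)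
  renaming (_+_ to _+ℕ_; _*_ to _*ℕ_)
import Data.Nat.Properties as ℕ
open import Data.Nat.Combinatorics using (_C_; nCk+nC[k+1]≡[n+1]C[k+1]; nC1≡n)
import Data.Nat.Solver as ℕ-Solver
open import Data.Product using (_,_)
open import Relation.Binary.Bundles using (Setoid)
open import Relation.Nullary using (yes; no)
open import Relation.Binary.PropositionalEquality as ≡
  using (_≡_; cong; cong₂; subst)
import Relation.Binary.Reasoning.Setoid as SetoidReasoning

open import Defs

module FormalPowerSeries (R : CommutativeRing 0ℓ 0ℓ) where

  open CommutativeRing R
  open SetoidReasoning setoid
  open CommSemigroupProperties +-commutativeSemigroup using (interchange)

  Σ : ℕ → (ℕ → Carrier) → Carrier
  Σ zero    f = f 0
  Σ (suc n) f = Σ n f + f (suc n)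

  Σ-cong : ∀ n {f g : ℕ → Carrier} → (∀ i → i ≤ n → f i ≈ g i) → Σ n f ≈ Σ n g
  Σ-cong zero    f≈g = f≈g 0 z≤n
  Σ-cong (suc n) f≈g =
    +-cong (Σ-cong n λ i i≤n → f≈g i (ℕ.m≤n⇒m≤1+n i≤n)) (f≈g (suc n) ℕ.≤-refl)

  Σ-zero : ∀ n (f : ℕ → Carrier) → (∀ i → i ≤ n → f i ≈ 0#) → Σ n f ≈ 0#
  Σ-zero zero    f f≈0 = f≈0 0 z≤n
  Σ-zero (suc n) f f≈0 =
    trans (+-cong (Σ-zero n f λ i i≤n → f≈0 i (ℕ.m≤n⇒m≤1+n i≤n)) (f≈0 (suc n) ℕ.≤-refl))
          (+-identityˡ 0#)

  Σ-+ : ∀ n (f g : ℕ → Carrier) → Σ n (λ i → f i + g i) ≈ Σ n f + Σ n g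
  Σ-+ zero    f g = refl
  Σ-+ (suc n) f g = trans (+-congʳ (Σ-+ n f g)) (interchange _ _ _ _)

  *-distribˡ-Σ : ∀ n c (f : ℕ → Carrier) → c * Σ n f ≈ Σ n (λ i → c * f i)
  *-distribˡ-Σ zero    c f = refl
  *-distribˡ-Σ (suc n) c f = trans (distribˡ c (Σ n f) (f (suc n))) (+-congʳ (*-distribˡ-Σ n c f))

  *-distribʳ-Σ : ∀ n c (f : ℕ → Carrier) → Σ n f * c ≈ Σ n (λ i → f i * c)
  *-distribʳ-Σ zero    c f = refl
  *-distribʳ-Σ (suc n) c f = trans (distribʳ c (Σ n f) (f (suc n))) (+-congʳ (*-distribʳ-Σ n c f))

  Σ-unfoldˡ : ∀ n (f : ℕ → Carrier) → Σ (suc n) f ≈ f 0 + Σ n (λ i → f (suc i))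
  Σ-unfoldˡ zero    f = refl
  Σ-unfoldˡ (suc n) f = trans (+-congʳ (Σ-unfoldˡ n f)) (+-assoc _ _ _)

  Σ-reverse : ∀ n (f : ℕ → Carrier) → Σ n f ≈ Σ n (λ i → f (n ∸ i))
  Σ-reverse zero    f = refl
  Σ-reverse (suc n) f = begin
    Σ n f + f (suc n)                  ≈⟨ +-congʳ (Σ-reverse n f) ⟩
    Σ n (λ i → f (n ∸ i)) + f (suc n)  ≈⟨ +-comm _ _ ⟩
    f (suc n) + Σ n (λ i → f (n ∸ i))  ≈⟨ Σ-unfoldˡ n (λ i → f (suc n ∸ i)) ⟨
    Σ (suc n) (λ i → f (suc n ∸ i))    ∎

  Σ-triangle : ∀ n (F : ℕ → ℕ → Carrier) →
    Σ n (λ i → Σ i (F i)) ≈ Σ n (λ j → Σ (n ∸ j) (λ m → F (j +ℕ m) j))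
  Σ-triangle zero    F = refl
  Σ-triangle (suc n) F = begin
      Σ n (λ i → Σ i (F i)) + (Σ n (F (suc n)) + F (suc n) (suc n))
    ≈⟨ +-congʳ (Σ-triangle n F) ⟩
      Σ n (λ j → Σ (n ∸ j) (λ m → F (j +ℕ m) j)) + (Σ n (F (suc n)) + F (suc n) (suc n))
    ≈⟨ +-assoc _ _ _ ⟨
      (Σ n (λ j → Σ (n ∸ j) (λ m → F (j +ℕ m) j)) + Σ n (F (suc n))) + F (suc n) (suc n)
    ≈⟨ +-cong (trans (sym (Σ-+ n _ _)) (Σ-cong n extend-row)) (reflexive diagonal) ⟩
      Σ n (λ j → Σ (suc n ∸ j) (λ m → F (j +ℕ m) j)) + Σ (suc n ∸ suc n) (λ m → F (suc n +ℕ m) (suc n))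
    ∎
    where
    diagonal : F (suc n) (suc n) ≡ Σ (n ∸ n) (λ m → F (suc n +ℕ m) (suc n))
    diagonal rewrite ℕ.n∸n≡0 n | ℕ.+-identityʳ n = ≡.refl
    extend-row : ∀ j → j ≤ n →
      Σ (n ∸ j) (λ m → F (j +ℕ m) j) + F (suc n) j ≈ Σ (suc n ∸ j) (λ m → F (j +ℕ m) j)
    extend-row j j≤n rewrite ℕ.+-∸-assoc 1 j≤n =
      +-congˡ (reflexive (cong (λ t → F t j) (≡.sym (≡.trans (ℕ.+-suc j (n ∸ j)) (cong suc (ℕ.m+[n∸m]≡n j≤n))))))

  PowerSeries : Set
  PowerSeries = ℕ → Carrier

  infix  4 _≈ₚ_
  infixl 6 _+ₚ_
  infixl 7 _*ₚ_

  _≈ₚ_ : PowerSeries → PowerSeries → Set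
  f ≈ₚ g = ∀ n → f n ≈ g n

  _+ₚ_ : PowerSeries → PowerSeries → PowerSeries
  (f +ₚ g) n = f n + g n

  -ₚ_ : PowerSeries → PowerSeries
  (-ₚ f) n = - f n

  0ₚ 1ₚ : PowerSeries
  0ₚ _ = 0#
  1ₚ zero    = 1#
  1ₚ (suc _) = 0#

  _*ₚ_ : PowerSeries → PowerSeries → PowerSeries
  (f *ₚ g) n = Σ n (λ i → f i * g (n ∸ i))

  *ₚ-comm : ∀ f g → f *ₚ g ≈ₚ g *ₚ f
  *ₚ-comm f g n = begin
    Σ n (λ i → f i * g (n ∸ i))              ≈⟨ Σ-reverse n _ ⟩
    Σ n (λ i → f (n ∸ i) * g (n ∸ (n ∸ i)))  ≈⟨ Σ-cong n swap ⟩
    Σ n (λ i → g i * f (n ∸ i))              ∎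
    where
    swap : ∀ i → i ≤ n → f (n ∸ i) * g (n ∸ (n ∸ i)) ≈ g i * f (n ∸ i)
    swap i i≤n = trans (*-comm _ _) (*-congʳ (reflexive (cong g (ℕ.m∸[m∸n]≡n i≤n))))

  *ₚ-assoc : ∀ f g h → (f *ₚ g) *ₚ h ≈ₚ f *ₚ (g *ₚ h)
  *ₚ-assoc f g h n = begin
      Σ n (λ i → Σ i (λ j → f j * g (i ∸ j)) * h (n ∸ i))
    ≈⟨ Σ-cong n (λ i _ → *-distribʳ-Σ i _ _) ⟩
      Σ n (λ i → Σ i (λ j → f j * g (i ∸ j) * h (n ∸ i)))
    ≈⟨ Σ-triangle n _ ⟩
      Σ n (λ j → Σ (n ∸ j) (λ m → f j * g ((j +ℕ m) ∸ j) * h (n ∸ (j +ℕ m))))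
    ≈⟨ Σ-cong n (λ j _ → Σ-cong (n ∸ j) (λ m _ → trans (*-assoc _ _ _) (*-congˡ (reindex j m)))) ⟩
      Σ n (λ j → Σ (n ∸ j) (λ m → f j * (g m * h ((n ∸ j) ∸ m))))
    ≈⟨ Σ-cong n (λ j _ → *-distribˡ-Σ (n ∸ j) _ _) ⟨
      Σ n (λ j → f j * Σ (n ∸ j) (λ m → g m * h ((n ∸ j) ∸ m)))
    ∎
    where
    reindex : ∀ j m → g ((j +ℕ m) ∸ j) * h (n ∸ (j +ℕ m)) ≈ g m * h ((n ∸ j) ∸ m)
    reindex j m = *-cong (reflexive (cong g (ℕ.m+n∸m≡n j m))) (reflexive (cong h (≡.sym (ℕ.∸-+-assoc n j m))))

  *ₚ-identityˡ : ∀ f → 1ₚ *ₚ f ≈ₚ f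
  *ₚ-identityˡ f zero    = *-identityˡ (f 0)
  *ₚ-identityˡ f (suc n) = begin
    Σ (suc n) (λ i → 1ₚ i * f (suc n ∸ i))        ≈⟨ Σ-unfoldˡ n _ ⟩
    1# * f (suc n) + Σ n (λ i → 0# * f (n ∸ i))   ≈⟨ +-cong (*-identityˡ _) (Σ-zero n _ (λ i _ → zeroˡ _)) ⟩
    f (suc n) + 0#                                 ≈⟨ +-identityʳ _ ⟩
    f (suc n)                                      ∎

  powerSeriesRing : CommutativeRing 0ℓ 0ℓ
  powerSeriesRing = record
    { Carrier = PowerSeries
    ; _≈_ = _≈ₚ_
    ; _+_ = _+ₚ_
    ; _*_ = _*ₚ_
    ; -_ = -ₚ_
    ; 0# = 0ₚ
    ; 1# = 1ₚ
    ; isCommutativeRing = record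
      { isRing = record
        { +-isAbelianGroup = record
          { isGroup = record
            { isMonoid = record
              { isSemigroup = record
                { isMagma = record
                  { isEquivalence = record
                    { refl = λ n → refl ; sym = λ p n → sym (p n) ; trans = λ p q n → trans (p n) (q n) }
                  ; ∙-cong = λ p q n → +-cong (p n) (q n) }
                ; assoc = λ f g h n → +-assoc (f n) (g n) (h n) }
              ; identity = (λ f n → +-identityˡ (f n)) , (λ f n → +-identityʳ (f n)) }
            ; inverse = (λ f n → -‿inverseˡ (f n)) , (λ f n → -‿inverseʳ (f n))
            ; ⁻¹-cong = λ p n → -‿cong (p n) }
          ; comm = λ f g n → +-comm (f n) (g n) }
        ; *-cong = λ p q n → Σ-cong n (λ i _ → *-cong (p i) (q (n ∸ i)))
        ; *-assoc = *ₚ-assoc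
        ; *-identity = *ₚ-identityˡ , (λ f n → trans (*ₚ-comm f 1ₚ n) (*ₚ-identityˡ f n))
        ; distrib = (λ f g h n → trans (Σ-cong n (λ i _ → distribˡ _ _ _)) (Σ-+ n _ _))
                  , (λ f g h n → trans (Σ-cong n (λ i _ → distribʳ _ _ _)) (Σ-+ n _ _)) }
      ; *-comm = *ₚ-comm }
    }

module _ (R : CommutativeRing 0ℓ 0ℓ) where
  open CommutativeRing R
  open FormalPowerSeries R
  open FormalPowerSeries powerSeriesRing using () renaming (Σ to Σₚ)

  Σₚ-coeff : ∀ n (F : ℕ → PowerSeries) m → Σₚ n F m ≈ Σ n (λ i → F i m)
  Σₚ-coeff zero    F m = refl
  Σₚ-coeff (suc n) F m = +-congʳ (Σₚ-coeff n F m)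

module SeriesRing where

  open ≡ using (refl; sym; trans)
  open FormalPowerSeries ℤ.+-*-commutativeRing using (Σ; Σ-cong; Σ-zero)
    renaming (powerSeriesRing to ℤ[[q]])

  ℤ[[a,x,q]] : CommutativeRing 0ℓ 0ℓ
  ℤ[[a,x,q]] = FormalPowerSeries.powerSeriesRing (FormalPowerSeries.powerSeriesRing ℤ[[q]])

  module Iterated = CommutativeRing ℤ[[a,x,q]]

  -- A record rather than a function type, so that f and g can be inferred
  -- from the type f ≈S g.
  infix 4 _≈S_
  record _≈S_ (f g : Series) : Set where
    constructor mkS
    field coeff : ∀ d e l → f d e l ≡ g d e l
  open _≈S_ public

  Σ≤≡Σ : ∀ n f → Σ≤ n f ≡ Σ n f
  Σ≤≡Σ zero    f = refl
  Σ≤≡Σ (suc n) f = cong (_+ℤ f (suc n)) (Σ≤≡Σ n f)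

  Σ≤-cong : ∀ n {f g} → (∀ i → i ≤ n → f i ≡ g i) → Σ≤ n f ≡ Σ≤ n g
  Σ≤-cong n {f} {g} f≡g = trans (Σ≤≡Σ n f) (trans (Σ-cong n f≡g) (sym (Σ≤≡Σ n g)))

  Σ≤-zero : ∀ n (f : ℕ → ℤ) → (∀ i → i ≤ n → f i ≡ 0ℤ) → Σ≤ n f ≡ 0ℤ
  Σ≤-zero n f f≡0 = trans (Σ≤≡Σ n f) (Σ-zero n f f≡0)

  Σ≤-head : ∀ n (f : ℕ → ℤ) → (∀ i → f (suc i) ≡ 0ℤ) → Σ≤ n f ≡ f 0
  Σ≤-head zero    f tail≡0 = refl
  Σ≤-head (suc n) f tail≡0 = trans (cong₂ _+ℤ_ (Σ≤-head n f tail≡0) (tail≡0 n)) (ℤ.+-identityʳ (f 0))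

  *S≡Iterated : ∀ f g → (f *S g) ≈S (f Iterated.* g)
  *S≡Iterated f g = mkS coeff-*S
    where
    open FormalPowerSeries ℤ[[q]] using () renaming (Σ to Σₚ; _*ₚ_ to _*ₓ_)
    coeff-*S : ∀ d e l → (f *S g) d e l ≡ (f Iterated.* g) d e l
    coeff-*S d e l = sym (begin
        (f Iterated.* g) d e l
      ≡⟨ Σₚ-coeff ℤ[[q]] d H e l ⟩
        Σₚ d (λ i → H i e) l
      ≡⟨ Σₚ-coeff ℤ.+-*-commutativeRing d (λ i → H i e) l ⟩
        Σ d (λ i → H i e l)
      ≡⟨ Σ-cong d (λ i _ → trans (Σₚ-coeff ℤ.+-*-commutativeRing e _ l) (Σ-cong e (λ j _ → sym (Σ≤≡Σ l _)))) ⟩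
        Σ d (λ i → Σ e (λ j → Σ≤ l (λ m → f i j m *ℤ g (d ∸ i) (e ∸ j) (l ∸ m))))
      ≡⟨ Σ-cong d (λ i _ → sym (Σ≤≡Σ e _)) ⟩
        Σ d (λ i → Σ≤ e (λ j → Σ≤ l (λ m → f i j m *ℤ g (d ∸ i) (e ∸ j) (l ∸ m))))
      ≡⟨ Σ≤≡Σ d _ ⟨
        (f *S g) d e l ∎)
      where
      open ≡.≡-Reasoning
      H : ℕ → ℕ → ℕ → ℤ
      H i = f i *ₓ g (d ∸ i)

  ≈S-setoid : Setoid 0ℓ 0ℓ
  ≈S-setoid = record
    { Carrier = Series
    ; _≈_ = _≈S_
    ; isEquivalence = record
      { refl = mkS λ _ _ _ → refl
      ; sym = λ p → mkS λ d e l → sym (coeff p d e l)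
      ; trans = λ p q → mkS λ d e l → trans (coeff p d e l) (coeff q d e l) } }

  open SetoidReasoning ≈S-setoid
  open Setoid ≈S-setoid using () renaming (refl to ≈S-refl; trans to ≈S-trans)

  1S≈Iterated-1 : 1S ≈S Iterated.1#
  1S≈Iterated-1 = mkS coeff-1
    where
    coeff-1 : ∀ d e l → 1S d e l ≡ Iterated.1# d e l
    coeff-1 zero    zero    zero    = refl
    coeff-1 zero    zero    (suc l) = refl
    coeff-1 zero    (suc e) l       = refl
    coeff-1 (suc d) e       l       = refl

  +S-cong : ∀ {f f' g g'} → f ≈S f' → g ≈S g' → f +S g ≈S f' +S g'
  +S-cong f≈f' g≈g' = mkS λ d e l → cong₂ _+ℤ_ (coeff f≈f' d e l) (coeff g≈g' d e l)

  *S-cong : ∀ {f f' g g'} → f ≈S f' → g ≈S g' → (f *S g) ≈S (f' *S g')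
  *S-cong {f} {f'} {g} {g'} f≈f' g≈g' = begin
    f *S g            ≈⟨ *S≡Iterated f g ⟩
    f Iterated.* g    ≈⟨ mkS (Iterated.*-cong (coeff f≈f') (coeff g≈g')) ⟩
    f' Iterated.* g'  ≈⟨ *S≡Iterated f' g' ⟨
    f' *S g'          ∎

  *S-assoc : ∀ f g h → ((f *S g) *S h) ≈S (f *S (g *S h))
  *S-assoc f g h = begin
    (f *S g) *S h                    ≈⟨ *S-cong (*S≡Iterated f g) (≈S-refl {h}) ⟩
    (f Iterated.* g) *S h            ≈⟨ *S≡Iterated (f Iterated.* g) h ⟩
    (f Iterated.* g) Iterated.* h    ≈⟨ mkS (Iterated.*-assoc f g h) ⟩
    f Iterated.* (g Iterated.* h)    ≈⟨ *S≡Iterated f (g Iterated.* h) ⟨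
    f *S (g Iterated.* h)            ≈⟨ *S-cong (≈S-refl {f}) (*S≡Iterated g h) ⟨
    f *S (g *S h)                    ∎

  *S-comm : ∀ f g → (f *S g) ≈S (g *S f)
  *S-comm f g = begin
    f *S g          ≈⟨ *S≡Iterated f g ⟩
    f Iterated.* g  ≈⟨ mkS (Iterated.*-comm f g) ⟩
    g Iterated.* f  ≈⟨ *S≡Iterated g f ⟨
    g *S f          ∎

  *S-identityˡ : ∀ f → (1S *S f) ≈S f
  *S-identityˡ f = begin
    1S *S f                   ≈⟨ *S-cong 1S≈Iterated-1 (≈S-refl {f}) ⟩
    Iterated.1# *S f          ≈⟨ *S≡Iterated Iterated.1# f ⟩
    Iterated.1# Iterated.* f  ≈⟨ mkS (Iterated.*-identityˡ f) ⟩
    f                         ∎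

  *S-distribˡ : ∀ f g h → (f *S (g +S h)) ≈S ((f *S g) +S (f *S h))
  *S-distribˡ f g h = begin
    f *S (g +S h)                            ≈⟨ *S≡Iterated f (g +S h) ⟩
    f Iterated.* (g +S h)                    ≈⟨ mkS (Iterated.distribˡ f g h) ⟩
    (f Iterated.* g) +S (f Iterated.* h)     ≈⟨ +S-cong (*S≡Iterated f g) (*S≡Iterated f h) ⟨
    (f *S g) +S (f *S h)                     ∎

  seriesRing : CommutativeRing 0ℓ 0ℓ
  seriesRing = record
    { Carrier = Series
    ; _≈_ = _≈S_
    ; _+_ = _+S_
    ; _*_ = _*S_
    ; -_ = -S_
    ; 0# = 0S
    ; 1# = 1S
    ; isCommutativeRing = record
      { isRing = record
        { +-isAbelianGroup = record
          { isGroup = record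
            { isMonoid = record
              { isSemigroup = record
                { isMagma = record
                  { isEquivalence = Setoid.isEquivalence ≈S-setoid
                  ; ∙-cong = +S-cong }
                ; assoc = λ f g h → mkS (λ d e l → ℤ.+-assoc (f d e l) (g d e l) (h d e l)) }
              ; identity = (λ f → mkS (λ d e l → ℤ.+-identityˡ (f d e l)))
                         , (λ f → mkS (λ d e l → ℤ.+-identityʳ (f d e l))) }
            ; inverse = (λ f → mkS (λ d e l → ℤ.+-inverseˡ (f d e l)))
                      , (λ f → mkS (λ d e l → ℤ.+-inverseʳ (f d e l)))
            ; ⁻¹-cong = λ p → mkS (λ d e l → cong -ℤ_ (coeff p d e l)) }
          ; comm = λ f g → mkS (λ d e l → ℤ.+-comm (f d e l) (g d e l)) }
        ; *-cong = *S-cong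
        ; *-assoc = *S-assoc
        ; *-identity = *S-identityˡ , (λ f → ≈S-trans (*S-comm f 1S) (*S-identityˡ f))
        ; distrib = *S-distribˡ
                  , (λ f g h → ≈S-trans (*S-comm (g +S h) f) (≈S-trans (*S-distribˡ f g h)
                      (+S-cong (*S-comm f g) (*S-comm f h)))) }
      ; *-comm = *S-comm }
    }

  -- Opaque copies of the ring operations, so that the ring solver compares
  -- normal forms syntactically instead of unfolding Cauchy products.
  opaque
    infixl 6 _⊕_
    infixl 7 _⊗_
    infix  8 ⊖_

    _⊕_ _⊗_ : Series → Series → Series
    _⊕_ = _+S_
    _⊗_ = _*S_

    ⊖_ : Series → Series
    ⊖_ = -S_

  opaque
    unfolding _⊕_ _⊗_ ⊖_

    ⊕≡+S : ∀ f g → f ⊕ g ≡ f +S g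
    ⊕≡+S f g = refl

    ⊗≡*S : ∀ f g → f ⊗ g ≡ f *S g
    ⊗≡*S f g = refl

    ⊖≡-S : ∀ f → ⊖ f ≡ -S f
    ⊖≡-S f = refl

    series-isCommutativeRing : IsCommutativeRing _≈S_ _⊕_ _⊗_ ⊖_ 0S 1S
    series-isCommutativeRing = CommutativeRing.isCommutativeRing seriesRing

  infixl 6 _⊝_
  _⊝_ : Series → Series → Series
  f ⊝ g = f ⊕ ⊖ g

  series : CommutativeRing 0ℓ 0ℓ
  series = record { isCommutativeRing = series-isCommutativeRing }

  module S = CommutativeRing series

  scalar : ℤ → Series
  scalar z zero zero zero = z
  scalar z _    _    _    = 0ℤ

  scalar-*S : ∀ z g → (scalar z *S g) ≈S (λ d e l → z *ℤ g d e l)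
  scalar-*S z g = mkS λ d e l →
    trans (Σ≤-head d _ (λ _ → Σ≤-zero e _ (λ _ _ → Σ≤-zero l _ (λ _ _ → refl))))
      (trans (Σ≤-head e _ (λ _ → Σ≤-zero l _ (λ _ _ → refl)))
        (Σ≤-head l _ (λ _ → refl)))

  scalar-+ : ∀ z w → scalar (z +ℤ w) ≈S scalar z +S scalar w
  scalar-+ z w = mkS coeff-+
    where
    coeff-+ : ∀ d e l → scalar (z +ℤ w) d e l ≡ scalar z d e l +ℤ scalar w d e l
    coeff-+ zero    zero    zero    = refl
    coeff-+ zero    zero    (suc l) = refl
    coeff-+ zero    (suc e) l       = refl
    coeff-+ (suc d) e       l       = refl

  scalar-neg : ∀ z → scalar (-ℤ z) ≈S -S scalar z
  scalar-neg z = mkS coeff-neg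
    where
    coeff-neg : ∀ d e l → scalar (-ℤ z) d e l ≡ -ℤ scalar z d e l
    coeff-neg zero    zero    zero    = refl
    coeff-neg zero    zero    (suc l) = refl
    coeff-neg zero    (suc e) l       = refl
    coeff-neg (suc d) e       l       = refl

  scalar-* : ∀ z w → scalar (z *ℤ w) ≈S (scalar z *S scalar w)
  scalar-* z w = S.trans (mkS coeff-*) (S.sym (scalar-*S z (scalar w)))
    where
    coeff-* : ∀ d e l → scalar (z *ℤ w) d e l ≡ z *ℤ scalar w d e l
    coeff-* zero    zero    zero    = refl
    coeff-* zero    zero    (suc l) = sym (ℤ.*-zeroʳ z)
    coeff-* zero    (suc e) l       = sym (ℤ.*-zeroʳ z)
    coeff-* (suc d) e       l       = sym (ℤ.*-zeroʳ z)

  scalar-0 : 0S ≈S scalar 0ℤ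
  scalar-0 = mkS coeff-0
    where
    coeff-0 : ∀ d e l → 0S d e l ≡ scalar 0ℤ d e l
    coeff-0 zero    zero    zero    = refl
    coeff-0 zero    zero    (suc l) = refl
    coeff-0 zero    (suc e) l       = refl
    coeff-0 (suc d) e       l       = refl

  scalar-1 : 1S ≈S scalar 1ℤ
  scalar-1 = mkS coeff-1
    where
    coeff-1 : ∀ d e l → 1S d e l ≡ scalar 1ℤ d e l
    coeff-1 zero    zero    zero    = refl
    coeff-1 zero    zero    (suc l) = refl
    coeff-1 zero    (suc e) l       = refl
    coeff-1 (suc d) e       l       = refl

  -- The solver's constants: 0 and 1 are sent to 0S and 1S themselves, so
  -- that they match the literals 0S and 1S occurring in the goals.
  constant : ℤ → Series
  constant (+ zero)       = 0S
  constant (+ suc zero)   = 1S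
  constant z              = scalar z

  constant≈scalar : ∀ z → constant z ≈S scalar z
  constant≈scalar (+ zero)          = scalar-0
  constant≈scalar (+ suc zero)      = scalar-1
  constant≈scalar (+ suc (suc n))   = S.refl
  constant≈scalar -[1+ n ]          = S.refl

  constant-homomorphism :
    CommutativeRing.rawRing ℤ.+-*-commutativeRing -Raw-AlmostCommutative⟶ fromCommutativeRing series
  constant-homomorphism = record
    { ⟦_⟧ = constant
    ; +-homo = λ z w → begin
        constant (z +ℤ w)             ≈⟨ constant≈scalar (z +ℤ w) ⟩
        scalar (z +ℤ w)               ≈⟨ scalar-+ z w ⟩
        scalar z +S scalar w          ≈⟨ +S-cong (constant≈scalar z) (constant≈scalar w) ⟨
        constant z +S constant w      ≈⟨ S.reflexive (sym (⊕≡+S (constant z) (constant w))) ⟩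
        constant z ⊕ constant w       ∎
    ; *-homo = λ z w → begin
        constant (z *ℤ w)             ≈⟨ constant≈scalar (z *ℤ w) ⟩
        scalar (z *ℤ w)               ≈⟨ scalar-* z w ⟩
        scalar z *S scalar w          ≈⟨ *S-cong (constant≈scalar z) (constant≈scalar w) ⟨
        constant z *S constant w      ≈⟨ S.reflexive (sym (⊗≡*S (constant z) (constant w))) ⟩
        constant z ⊗ constant w       ∎
    ; -‿homo = λ z → begin
        constant (-ℤ z)               ≈⟨ constant≈scalar (-ℤ z) ⟩
        scalar (-ℤ z)                 ≈⟨ scalar-neg z ⟩
        -S scalar z                   ≈⟨ -S-cong (constant≈scalar z) ⟨
        -S constant z                 ≈⟨ S.reflexive (sym (⊖≡-S (constant z))) ⟩
        ⊖ constant z                  ∎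
    ; 0-homo = S.refl
    ; 1-homo = S.refl
    }
    where
    open CommutativeRing seriesRing using () renaming (-‿cong to -S-cong)

  constant-≟ : ∀ z w → Maybe (constant z ≈S constant w)
  constant-≟ z w with z ℤ.≟ w
  ... | yes refl = just S.refl
  ... | no _     = nothing

  module Solver = RingSolver (CommutativeRing.rawRing ℤ.+-*-commutativeRing)
    (fromCommutativeRing series) constant-homomorphism constant-≟

open SeriesRing
open ≡ using (refl; sym; trans)
open Solver using (solve; _:=_; _:+_; _:*_; _:-_; :-_; con)
module ≈S-Reasoning = SetoidReasoning S.setoid
open ℕ-Solver.+-*-Solver using ()
  renaming (solve to solveℕ; _:=_ to _:=ℕ_; _:+_ to _:+ℕ_; _:*_ to _:*ℕ_; con to conℕ)

⊕-coeff : ∀ f g d e l → (f ⊕ g) d e l ≡ f d e l +ℤ g d e l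
⊕-coeff f g d e l = cong (λ h → h d e l) (⊕≡+S f g)

⊗-coeff : ∀ f g d e l → (f ⊗ g) d e l ≡ (f *S g) d e l
⊗-coeff f g d e l = cong (λ h → h d e l) (⊗≡*S f g)

⊖-coeff : ∀ f d e l → (⊖ f) d e l ≡ -ℤ f d e l
⊖-coeff f d e l = cong (λ h → h d e l) (⊖≡-S f)

*S≈⊗ : ∀ {f f' g g'} → f ≈S f' → g ≈S g' → f *S g ≈S f' ⊗ g'
*S≈⊗ {f' = f'} {g' = g'} f≈f' g≈g' = S.trans (*S-cong f≈f' g≈g') (S.reflexive (sym (⊗≡*S f' g')))

-S≈⊖ : ∀ {f f'} → f ≈S f' → -S f ≈S ⊖ f'
-S≈⊖ {f' = f'} f≈f' = S.trans (mkS λ d e l → cong -ℤ_ (coeff f≈f' d e l)) (S.reflexive (sym (⊖≡-S f')))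

-S≈⊝ : ∀ {f f' g g'} → f ≈S f' → g ≈S g' → f -S g ≈S f' ⊝ g'
-S≈⊝ {f' = f'} {g' = g'} f≈f' g≈g' = S.trans
  (mkS λ d e l → cong₂ _+ℤ_ (coeff f≈f' d e l) (coeff (-S≈⊖ g≈g') d e l))
  (S.reflexive (sym (⊕≡+S f' (⊖ g'))))

Σ≤-second : ∀ n (f : ℕ → ℤ) → f 0 ≡ 0ℤ → (∀ i → f (suc (suc i)) ≡ 0ℤ) → Σ≤ (suc n) f ≡ f 1
Σ≤-second zero    f f0≡0 _      = trans (cong (_+ℤ f 1) f0≡0) (ℤ.+-identityˡ (f 1))
Σ≤-second (suc n) f f0≡0 tail≡0 =
  trans (cong₂ _+ℤ_ (Σ≤-second n f f0≡0 tail≡0) (tail≡0 n)) (ℤ.+-identityʳ (f 1))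

aShift xShift qShift : Series → Series
aShift f zero    e l = 0ℤ
aShift f (suc d) e l = f d e l
xShift f d zero    l = 0ℤ
xShift f d (suc e) l = f d e l
qShift f d e zero    = 0ℤ
qShift f d e (suc l) = f d e l

Σ≤-unit : ∀ l (g : ℕ → ℤ) → Σ≤ l (λ l₁ → 1S 0 0 l₁ *ℤ g l₁) ≡ g 0
Σ≤-unit l g = trans (Σ≤-head l _ (λ _ → refl)) (ℤ.*-identityˡ (g 0))

aS-⊗ : ∀ f → aS ⊗ f ≈S aShift f
aS-⊗ f = mkS coeff-a
  where
  coeff-a : ∀ d e l → (aS ⊗ f) d e l ≡ aShift f d e l
  coeff-a zero    e l = trans (⊗-coeff aS f zero e l) (Σ≤-zero e _ (λ _ _ → Σ≤-zero l _ (λ _ _ → refl)))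
  coeff-a (suc d) e l = trans (⊗-coeff aS f (suc d) e l)
    (trans (Σ≤-second d _ (Σ≤-zero e _ (λ _ _ → Σ≤-zero l _ (λ _ _ → refl)))
                          (λ _ → Σ≤-zero e _ (λ _ _ → Σ≤-zero l _ (λ _ _ → refl))))
      (trans (Σ≤-head e _ (λ _ → Σ≤-zero l _ (λ _ _ → refl))) (Σ≤-unit l (λ l₁ → f d e (l ∸ l₁)))))

xS-⊗ : ∀ f → xS ⊗ f ≈S xShift f
xS-⊗ f = mkS λ d e l → trans (⊗-coeff xS f d e l)
  (trans (Σ≤-head d _ (λ _ → Σ≤-zero e _ (λ _ _ → Σ≤-zero l _ (λ _ _ → refl)))) (coeff-x d e l))
  where
  coeff-x : ∀ d e l → Σ≤ e (λ e₁ → Σ≤ l (λ l₁ → xS 0 e₁ l₁ *ℤ f d (e ∸ e₁) (l ∸ l₁))) ≡ xShift f d e l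
  coeff-x d zero    l = Σ≤-zero l _ (λ _ _ → refl)
  coeff-x d (suc e) l =
    trans (Σ≤-second e _ (Σ≤-zero l _ (λ _ _ → refl)) (λ _ → Σ≤-zero l _ (λ _ _ → refl)))
      (trans (Σ≤-cong l (λ _ _ → refl)) (Σ≤-unit l (λ l₁ → f d e (l ∸ l₁))))

qS-⊗ : ∀ f → qS ⊗ f ≈S qShift f
qS-⊗ f = mkS λ d e l → trans (⊗-coeff qS f d e l)
  (trans (Σ≤-head d _ (λ _ → Σ≤-zero e _ (λ _ _ → Σ≤-zero l _ (λ _ _ → refl))))
    (trans (Σ≤-head e _ (λ _ → Σ≤-zero l _ (λ _ _ → refl))) (coeff-q d e l)))
  where
  coeff-q : ∀ d e l → Σ≤ l (λ l₁ → qS 0 0 l₁ *ℤ f d e (l ∸ l₁)) ≡ qShift f d e l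
  coeff-q d e zero    = refl
  coeff-q d e (suc l) = trans (Σ≤-second l _ refl (λ _ → refl)) (ℤ.*-identityˡ _)

mono-suc-a : ∀ d e l → mono (suc d) e l ≈S aS ⊗ mono d e l
mono-suc-a d e l = S.sym (S.trans (aS-⊗ (mono d e l)) (mkS shifted))
  where
  shifted : ∀ d' e' l' → aShift (mono d e l) d' e' l' ≡ mono (suc d) e l d' e' l'
  shifted zero     e' l' = refl
  shifted (suc d') e' l' = refl

mono-suc-x : ∀ d e l → mono d (suc e) l ≈S xS ⊗ mono d e l
mono-suc-x d e l = S.sym (S.trans (xS-⊗ (mono d e l)) (mkS shifted))
  where
  shifted : ∀ d' e' l' → xShift (mono d e l) d' e' l' ≡ mono d (suc e) l d' e' l'
  shifted d' zero l' with d ≡ᵇ d'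
  ... | false = refl
  ... | true  = refl
  shifted d' (suc e') l' = refl

mono-suc-q : ∀ d e l → mono d e (suc l) ≈S qS ⊗ mono d e l
mono-suc-q d e l = S.sym (S.trans (qS-⊗ (mono d e l)) (mkS shifted))
  where
  shifted : ∀ d' e' l' → qShift (mono d e l) d' e' l' ≡ mono d e (suc l) d' e' l'
  shifted d' e' zero with d ≡ᵇ d' | e ≡ᵇ e'
  ... | false | _     = refl
  ... | true  | false = refl
  ... | true  | true  = refl
  shifted d' e' (suc l') = refl

infixr 8 _^_
_^_ : Series → ℕ → Series
f ^ zero  = 1S
f ^ suc n = f ⊗ f ^ n

^S≈^ : ∀ f n → f ^S n ≈S f ^ n
^S≈^ f zero    = S.refl
^S≈^ f (suc n) = *S≈⊗ S.refl (^S≈^ f n)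

^-cong : ∀ {f g} n → f ≈S g → f ^ n ≈S g ^ n
^-cong zero    f≈g = S.refl
^-cong (suc n) f≈g = S.*-cong f≈g (^-cong n f≈g)

^-+ : ∀ f m n → f ^ (m +ℕ n) ≈S f ^ m ⊗ f ^ n
^-+ f zero    n = S.sym (S.*-identityˡ _)
^-+ f (suc m) n = S.trans (S.*-congˡ (^-+ f m n)) (S.sym (S.*-assoc _ _ _))

^-* : ∀ f t m → f ^ (t *ℕ m) ≈S (f ^ m) ^ t
^-* f zero    m = S.refl
^-* f (suc t) m = S.trans (^-+ f m (t *ℕ m)) (S.*-congˡ (^-* f t m))

∏< : ℕ → (ℕ → Series) → Series
∏< zero    F = 1S
∏< (suc n) F = ∏< n F ⊗ F n

Π<≈∏< : ∀ n {F G} → (∀ m → F m ≈S G m) → Π< n F ≈S ∏< n G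
Π<≈∏< zero    F≈G = S.refl
Π<≈∏< (suc n) F≈G = *S≈⊗ (Π<≈∏< n F≈G) (F≈G n)

∏<-cong : ∀ n {F G} → (∀ m → F m ≈S G m) → ∏< n F ≈S ∏< n G
∏<-cong zero    F≈G = S.refl
∏<-cong (suc n) F≈G = S.*-cong (∏<-cong n F≈G) (F≈G n)

∏<-unfoldˡ : ∀ n F → ∏< (suc n) F ≈S F 0 ⊗ ∏< n (λ m → F (suc m))
∏<-unfoldˡ zero    F = S.*-comm _ _
∏<-unfoldˡ (suc n) F = S.trans (S.*-congʳ (∏<-unfoldˡ n F)) (S.*-assoc _ _ _)

mono≈powers : ∀ d e l → mono d e l ≈S aS ^ d ⊗ (xS ^ e ⊗ qS ^ l)
mono≈powers (suc d) e l =
  S.trans (mono-suc-a d e l) (S.trans (S.*-congˡ (mono≈powers d e l)) (S.sym (S.*-assoc _ _ _)))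
mono≈powers zero (suc e) l = S.trans (mono-suc-x 0 e l) (S.trans (S.*-congˡ (mono≈powers 0 e l))
  (solve 3 (λ a x y → a :* (con (+ 1) :* (x :* y)) := con (+ 1) :* (a :* x :* y)) S.refl xS (xS ^ e) (qS ^ l)))
mono≈powers zero zero (suc l) = S.trans (mono-suc-q 0 0 l) (S.trans (S.*-congˡ (mono≈powers 0 0 l))
  (solve 2 (λ q y → q :* (con (+ 1) :* (con (+ 1) :* y)) := con (+ 1) :* (con (+ 1) :* (q :* y))) S.refl qS (qS ^ l)))
mono≈powers zero zero zero = S.sym (S.trans (S.*-identityˡ _) (S.*-identityˡ _))

mono-⊗ : ∀ d₁ e₁ l₁ d₂ e₂ l₂ →
  mono d₁ e₁ l₁ ⊗ mono d₂ e₂ l₂ ≈S mono (d₁ +ℕ d₂) (e₁ +ℕ e₂) (l₁ +ℕ l₂)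
mono-⊗ d₁ e₁ l₁ d₂ e₂ l₂ = begin
    mono d₁ e₁ l₁ ⊗ mono d₂ e₂ l₂
  ≈⟨ S.*-cong (mono≈powers d₁ e₁ l₁) (mono≈powers d₂ e₂ l₂) ⟩
    (aS ^ d₁ ⊗ (xS ^ e₁ ⊗ qS ^ l₁)) ⊗ (aS ^ d₂ ⊗ (xS ^ e₂ ⊗ qS ^ l₂))
  ≈⟨ solve 6 (λ a₁ x₁ q₁ a₂ x₂ q₂ → (a₁ :* (x₁ :* q₁)) :* (a₂ :* (x₂ :* q₂))
                                  := (a₁ :* a₂) :* ((x₁ :* x₂) :* (q₁ :* q₂)))
       S.refl (aS ^ d₁) (xS ^ e₁) (qS ^ l₁) (aS ^ d₂) (xS ^ e₂) (qS ^ l₂) ⟩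
    (aS ^ d₁ ⊗ aS ^ d₂) ⊗ ((xS ^ e₁ ⊗ xS ^ e₂) ⊗ (qS ^ l₁ ⊗ qS ^ l₂))
  ≈⟨ S.*-cong (^-+ aS d₁ d₂) (S.*-cong (^-+ xS e₁ e₂) (^-+ qS l₁ l₂)) ⟨
    aS ^ (d₁ +ℕ d₂) ⊗ (xS ^ (e₁ +ℕ e₂) ⊗ qS ^ (l₁ +ℕ l₂))
  ≈⟨ mono≈powers (d₁ +ℕ d₂) (e₁ +ℕ e₂) (l₁ +ℕ l₂) ⟨
    mono (d₁ +ℕ d₂) (e₁ +ℕ e₂) (l₁ +ℕ l₂)
  ∎
  where open ≈S-Reasoning

-- Orders and truncation

Weight : Set
Weight = ℕ → ℕ → ℕ → ℕ

xDegree qDegree xqDegree : Weight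
xDegree  d e l = e
qDegree  d e l = l
xqDegree d e l = e +ℕ l

Superadditive : Weight → Set
Superadditive w = ∀ d e l d₁ e₁ l₁ → d₁ ≤ d → e₁ ≤ e → l₁ ≤ l →
  w d₁ e₁ l₁ +ℕ w (d ∸ d₁) (e ∸ e₁) (l ∸ l₁) ≤ w d e l

xDegree-superadditive : Superadditive xDegree
xDegree-superadditive d e l d₁ e₁ l₁ _ e₁≤e _ = ℕ.≤-reflexive (ℕ.m+[n∸m]≡n e₁≤e)

qDegree-superadditive : Superadditive qDegree
qDegree-superadditive d e l d₁ e₁ l₁ _ _ l₁≤l = ℕ.≤-reflexive (ℕ.m+[n∸m]≡n l₁≤l)

xqDegree-superadditive : Superadditive xqDegree
xqDegree-superadditive d e l d₁ e₁ l₁ _ e₁≤e l₁≤l = ℕ.≤-reflexive (trans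
  (CommSemigroupProperties.interchange ℕ.+-commutativeSemigroup e₁ l₁ (e ∸ e₁) (l ∸ l₁))
  (cong₂ _+ℕ_ (ℕ.m+[n∸m]≡n e₁≤e) (ℕ.m+[n∸m]≡n l₁≤l)))

OrderAtLeast : Weight → ℕ → Series → Set
OrderAtLeast w s f = ∀ d e l → w d e l < s → f d e l ≡ 0ℤ

AgreeBelow : Weight → ℕ → Series → Series → Set
AgreeBelow w m f g = ∀ d e l → w d e l < m → f d e l ≡ g d e l

module _ {w : Weight} (w-superadditive : Superadditive w) where

  ⊗-coeff-cong : ∀ f g f' g' d e l →
    (∀ d₁ e₁ l₁ → d₁ ≤ d → e₁ ≤ e → l₁ ≤ l →
      f d₁ e₁ l₁ *ℤ g (d ∸ d₁) (e ∸ e₁) (l ∸ l₁) ≡ f' d₁ e₁ l₁ *ℤ g' (d ∸ d₁) (e ∸ e₁) (l ∸ l₁)) →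
    (f ⊗ g) d e l ≡ (f' ⊗ g') d e l
  ⊗-coeff-cong f g f' g' d e l terms≡ = trans (⊗-coeff f g d e l) (trans
    (Σ≤-cong d (λ d₁ p → Σ≤-cong e (λ e₁ q → Σ≤-cong l (λ l₁ r → terms≡ d₁ e₁ l₁ p q r))))
    (sym (⊗-coeff f' g' d e l)))

  order-⊗ : ∀ s t f g → OrderAtLeast w s f → OrderAtLeast w t g → OrderAtLeast w (s +ℕ t) (f ⊗ g)
  order-⊗ s t f g f-order g-order d e l w<s+t = trans (⊗-coeff f g d e l)
    (Σ≤-zero d _ (λ d₁ p → Σ≤-zero e _ (λ e₁ q → Σ≤-zero l _ (λ l₁ r → term≡0 d₁ e₁ l₁ p q r))))
    where
    term≡0 : ∀ d₁ e₁ l₁ → d₁ ≤ d → e₁ ≤ e → l₁ ≤ l → f d₁ e₁ l₁ *ℤ g (d ∸ d₁) (e ∸ e₁) (l ∸ l₁) ≡ 0ℤ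
    term≡0 d₁ e₁ l₁ p q r with w d₁ e₁ l₁ ℕ.<? s
    ... | yes w₁<s = cong (_*ℤ g (d ∸ d₁) (e ∸ e₁) (l ∸ l₁)) (f-order d₁ e₁ l₁ w₁<s)
    ... | no  w₁≮s = trans (cong (f d₁ e₁ l₁ *ℤ_) (g-order _ _ _ w₂<t)) (ℤ.*-zeroʳ (f d₁ e₁ l₁))
      where
      w₂<t : w (d ∸ d₁) (e ∸ e₁) (l ∸ l₁) < t
      w₂<t = ℕ.+-cancelˡ-< s _ t (ℕ.≤-<-trans
        (ℕ.≤-trans (ℕ.+-monoˡ-≤ _ (ℕ.≮⇒≥ w₁≮s)) (w-superadditive d e l d₁ e₁ l₁ p q r)) w<s+t)

  order-zero : ∀ f → OrderAtLeast w 0 f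
  order-zero f d e l ()

  order-⊗ˡ : ∀ s f g → OrderAtLeast w s f → OrderAtLeast w s (f ⊗ g)
  order-⊗ˡ s f g f-order = subst (λ u → OrderAtLeast w u (f ⊗ g)) (ℕ.+-identityʳ s)
    (order-⊗ s 0 f g f-order (order-zero g))

  order-⊗ʳ : ∀ s f g → OrderAtLeast w s g → OrderAtLeast w s (f ⊗ g)
  order-⊗ʳ s f g = order-⊗ 0 s f g (order-zero f)

  order-^ : ∀ g → OrderAtLeast w 1 g → ∀ n → OrderAtLeast w n (g ^ n)
  order-^ g g-order zero    = order-zero _
  order-^ g g-order (suc n) = order-⊗ 1 n g (g ^ n) g-order (order-^ g g-order n)

  agree-⊗ : ∀ m f f' g g' → AgreeBelow w m f f' → AgreeBelow w m g g' → AgreeBelow w m (f ⊗ g) (f' ⊗ g')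
  agree-⊗ m f f' g g' f≈f' g≈g' d e l w<m = ⊗-coeff-cong f g f' g' d e l λ d₁ e₁ l₁ p q r →
    let w₁+w₂≤w = w-superadditive d e l d₁ e₁ l₁ p q r in
    cong₂ _*ℤ_ (f≈f' d₁ e₁ l₁ (ℕ.≤-<-trans (ℕ.m+n≤o⇒m≤o _ w₁+w₂≤w) w<m))
               (g≈g' _ _ _ (ℕ.≤-<-trans (ℕ.m+n≤o⇒n≤o (w d₁ e₁ l₁) w₁+w₂≤w) w<m))

order-weaken : ∀ w s t f → t ≤ s → OrderAtLeast w s f → OrderAtLeast w t f
order-weaken w s t f t≤s f-order d e l w<t = f-order d e l (ℕ.<-≤-trans w<t t≤s)

agree-refl : ∀ w m f → AgreeBelow w m f f
agree-refl w m f d e l _ = refl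

agree-trans : ∀ w m {f g h} → AgreeBelow w m f g → AgreeBelow w m g h → AgreeBelow w m f h
agree-trans w m f≈g g≈h d e l w<m = trans (f≈g d e l w<m) (g≈h d e l w<m)

≈S⇒agree : ∀ w m {f g} → f ≈S g → AgreeBelow w m f g
≈S⇒agree w m f≈g d e l _ = coeff f≈g d e l

agree-weaken : ∀ w m n {f g} → n ≤ m → AgreeBelow w m f g → AgreeBelow w n f g
agree-weaken w m n n≤m f≈g d e l w<n = f≈g d e l (ℕ.<-≤-trans w<n n≤m)

agree-⊕ : ∀ w m {f f' g g'} → AgreeBelow w m f f' → AgreeBelow w m g g' → AgreeBelow w m (f ⊕ g) (f' ⊕ g')
agree-⊕ w m f≈f' g≈g' d e l w<m = trans (⊕-coeff _ _ d e l)
  (trans (cong₂ _+ℤ_ (f≈f' d e l w<m) (g≈g' d e l w<m)) (sym (⊕-coeff _ _ d e l)))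

agree-⊖ : ∀ w m {f f'} → AgreeBelow w m f f' → AgreeBelow w m (⊖ f) (⊖ f')
agree-⊖ w m f≈f' d e l w<m = trans (⊖-coeff _ d e l) (trans (cong -ℤ_ (f≈f' d e l w<m)) (sym (⊖-coeff _ d e l)))

qS-qOrder : OrderAtLeast qDegree 1 qS
qS-qOrder d e zero _ with 0 ≡ᵇ d | 0 ≡ᵇ e
... | false | _     = refl
... | true  | false = refl
... | true  | true  = refl
qS-qOrder d e (suc l) (s≤s ())

xS-xqOrder : OrderAtLeast xqDegree 1 xS
xS-xqOrder d zero zero _ with 0 ≡ᵇ d
... | false = refl
... | true  = refl
xS-xqOrder d (suc e) l       (s≤s ())
xS-xqOrder d zero    (suc l) (s≤s ())

qS-xqOrder : OrderAtLeast xqDegree 1 qS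
qS-xqOrder d zero zero _ with 0 ≡ᵇ d
... | false = refl
... | true  = refl
qS-xqOrder d (suc e) l       (s≤s ())
qS-xqOrder d zero    (suc l) (s≤s ())

mono-xOrder : ∀ d e l → OrderAtLeast xDegree e (mono d e l)
mono-xOrder d e l d' e' l' e'<e with d ≡ᵇ d' | e ≡ᵇ e' in e≡ᵇe'
... | false | _     = refl
... | true  | false = refl
... | true  | true  = ⊥-elim (ℕ.<⇒≢ e'<e (sym (ℕ.≡ᵇ⇒≡ e e' (subst T (sym e≡ᵇe') _))))

-- Infinite products and geometric series

TendsToOne : (ℕ → Series) → Set
TendsToOne F = ∀ m → AgreeBelow qDegree m (F m) 1S

∏<-stable-+ : ∀ F → TendsToOne F → ∀ n k → AgreeBelow qDegree n (∏< (k +ℕ n) F) (∏< n F)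
∏<-stable-+ F F→1 n zero    = agree-refl qDegree n _
∏<-stable-+ F F→1 n (suc k) = agree-trans qDegree n
  (agree-⊗ qDegree-superadditive n (∏< (k +ℕ n) F) (∏< (k +ℕ n) F) (F (k +ℕ n)) 1S
    (agree-refl qDegree n _) (agree-weaken qDegree (k +ℕ n) n (ℕ.m≤n+m n k) (F→1 (k +ℕ n))))
  (agree-trans qDegree n (≈S⇒agree qDegree n (S.*-identityʳ _)) (∏<-stable-+ F F→1 n k))

∏<-stable : ∀ F → TendsToOne F → ∀ n L → n ≤ L → AgreeBelow qDegree n (∏< L F) (∏< n F)
∏<-stable F F→1 n L n≤L =
  subst (λ u → AgreeBelow qDegree n (∏< u F) (∏< n F)) (ℕ.m∸n+n≡m n≤L) (∏<-stable-+ F F→1 n (L ∸ n))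

-- For factors with TendsToOne, the coefficient of q^l of the infinite
-- product only involves the factors m ≤ l (as in pochInf and invPochInf).
∏∞ : (ℕ → Series) → Series
∏∞ F d e l = ∏< (suc l) F d e l

∏∞-cong : ∀ {F G} → (∀ m → F m ≈S G m) → ∏∞ F ≈S ∏∞ G
∏∞-cong F≈G = mkS λ d e l → coeff (∏<-cong (suc l) F≈G) d e l

∏∞-unfoldˡ : ∀ F → TendsToOne F → ∏∞ F ≈S F 0 ⊗ ∏∞ (λ m → F (suc m))
∏∞-unfoldˡ F F→1 = mkS λ d e l → sym (begin
    (F 0 ⊗ ∏∞ G) d e l
  ≡⟨ agree-⊗ qDegree-superadditive (suc l) (F 0) (F 0) (∏∞ G) (∏< (suc l) G)
       (agree-refl qDegree _ _) ∏∞G≈partial d e l (ℕ.n<1+n l) ⟩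
    (F 0 ⊗ ∏< (suc l) G) d e l
  ≡⟨ coeff (∏<-unfoldˡ (suc l) F) d e l ⟨
    ∏< (suc (suc l)) F d e l
  ≡⟨ ∏<-stable F F→1 (suc l) (suc (suc l)) (ℕ.n≤1+n _) d e l (ℕ.n<1+n l) ⟩
    ∏∞ F d e l ∎)
  where
  open ≡.≡-Reasoning
  G : ℕ → Series
  G m = F (suc m)
  G→1 : TendsToOne G
  G→1 m = agree-weaken qDegree (suc m) m (ℕ.n≤1+n m) (F→1 (suc m))
  ∏∞G≈partial : ∀ {l} → AgreeBelow qDegree (suc l) (∏∞ G) (∏< (suc l) G)
  ∏∞G≈partial d' e' l' l'<1+l = sym (∏<-stable G G→1 (suc l') _ l'<1+l d' e' l' (ℕ.n<1+n l'))

sumTo : ℕ → (ℕ → Series) → Series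
sumTo zero    F = F 0
sumTo (suc n) F = sumTo n F ⊕ F (suc n)

sumTo-coeff : ∀ n F d e l → sumTo n F d e l ≡ Σ≤ n (λ i → F i d e l)
sumTo-coeff zero    F d e l = refl
sumTo-coeff (suc n) F d e l =
  trans (⊕-coeff (sumTo n F) (F (suc n)) d e l) (cong (_+ℤ F (suc n) d e l) (sumTo-coeff n F d e l))

Σ≤-extend : ∀ n N (f : ℕ → ℤ) → n ≤ N → (∀ i → n < i → f i ≡ 0ℤ) → Σ≤ N f ≡ Σ≤ n f
Σ≤-extend n N f n≤N tail≡0 = subst (λ u → Σ≤ u f ≡ Σ≤ n f) (ℕ.m∸n+n≡m n≤N) (extend (N ∸ n))
  where
  extend : ∀ k → Σ≤ (k +ℕ n) f ≡ Σ≤ n f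
  extend zero    = refl
  extend (suc k) =
    trans (cong₂ _+ℤ_ (extend k) (tail≡0 (suc (k +ℕ n)) (s≤s (ℕ.m≤n+m n k)))) (ℤ.+-identityʳ _)

Σ≤weight≈sumTo : ∀ w F N → (∀ i → OrderAtLeast w i (F i)) →
  AgreeBelow w (suc N) (λ d e l → Σ≤ (w d e l) (λ i → F i d e l)) (sumTo N F)
Σ≤weight≈sumTo w F N F-order d e l w<1+N = trans
  (sym (Σ≤-extend (w d e l) N _ (ℕ.≤-pred w<1+N) (λ i w<i → F-order i d e l w<i)))
  (sym (sumTo-coeff N F d e l))

geometric-telescope : ∀ g N → sumTo N (g ^_) ⊗ (1S ⊝ g) ≈S 1S ⊝ g ^ suc N
geometric-telescope g zero    =
  S.trans (S.*-identityˡ _) (S.+-congˡ (S.-‿cong (S.sym (S.*-identityʳ g))))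
geometric-telescope g (suc N) = S.trans (S.distribʳ _ _ _) (S.trans (S.+-congʳ (geometric-telescope g N))
  (solve 2 (λ p g → (con (+ 1) :- p) :+ p :* (con (+ 1) :- g) := con (+ 1) :- g :* p) S.refl (g ^ suc N) g))

geomInv-inverse : ∀ g → OrderAtLeast xqDegree 1 g → geomInv g ⊗ (1S ⊝ g) ≈S 1S
geomInv-inverse g g-order = mkS λ d e l → begin
    (geomInv g ⊗ (1S ⊝ g)) d e l
  ≡⟨ agree-⊗ xqDegree-superadditive (suc (e +ℕ l)) _ (sumTo (e +ℕ l) (g ^_)) _ (1S ⊝ g)
       (geomInv≈sumTo (e +ℕ l)) (agree-refl xqDegree _ _) d e l (ℕ.n<1+n _) ⟩
    (sumTo (e +ℕ l) (g ^_) ⊗ (1S ⊝ g)) d e l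
  ≡⟨ coeff (geometric-telescope g (e +ℕ l)) d e l ⟩
    (1S ⊝ g ^ suc (e +ℕ l)) d e l
  ≡⟨ ⊕-coeff 1S _ d e l ⟩
    1S d e l +ℤ (⊖ g ^ suc (e +ℕ l)) d e l
  ≡⟨ cong (1S d e l +ℤ_) (trans (⊖-coeff _ d e l)
       (cong -ℤ_ (order-^ xqDegree-superadditive g g-order _ d e l (ℕ.n<1+n _)))) ⟩
    1S d e l +ℤ 0ℤ
  ≡⟨ ℤ.+-identityʳ _ ⟩
    1S d e l ∎
  where
  open ≡.≡-Reasoning
  geomInv≈sumTo : ∀ N → AgreeBelow xqDegree (suc N) (geomInv g) (sumTo N (g ^_))
  geomInv≈sumTo N d e l w<1+N = trans (Σ≤-cong (e +ℕ l) (λ t _ → coeff (^S≈^ g t) d e l))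
    (Σ≤weight≈sumTo xqDegree (g ^_) N (order-^ xqDegree-superadditive g g-order) d e l w<1+N)

geomInv-cong : ∀ {g g'} → g ≈S g' → geomInv g ≈S geomInv g'
geomInv-cong {g} {g'} g≈g' = mkS λ d e l →
  Σ≤-cong (e +ℕ l) (λ t _ → coeff (^S-cong t) d e l)
  where
  ^S-cong : ∀ t → g ^S t ≈S g' ^S t
  ^S-cong t = S.trans (^S≈^ g t) (S.trans (^-cong t g≈g') (S.sym (^S≈^ g' t)))

geomInv-tendsToOne : ∀ h m → OrderAtLeast qDegree m h → AgreeBelow qDegree m (geomInv h) 1S
geomInv-tendsToOne h m h-order d e l l<m =
  Σ≤-head (e +ℕ l) _ (λ t → trans (coeff (^S≈^ h (suc t)) d e l)
    (order-⊗ˡ qDegree-superadditive m h (h ^ t) h-order d e l l<m))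

-- A n = (-a)^n (-1/a;q)_n, X n = (-x;q)_n, R n = 1/(q²;q²)_n,
-- P n = (-axq^{n+1};q)_∞ and I n = 1/(xq^n;q)_∞.
A X R P I : ℕ → Series
A n = ∏< n (λ m → ⊖ aS ⊝ qS ^ m)
X n = ∏< n (λ m → 1S ⊝ ⊖ xS ⊗ qS ^ m)
R n = ∏< n (λ m → geomInv (qS ^ (2 +ℕ 2 *ℕ m)))
P n = ∏∞ (λ m → 1S ⊝ (⊖ aS ⊗ xS) ⊗ qS ^ suc n ⊗ qS ^ m)
I n = ∏∞ (λ m → geomInv ((xS ⊗ qS ^ n) ⊗ qS ^ m))

term : ℕ → Series → Series → Series
term n M Y = A n ⊗ M ⊗ Y ⊗ X n ⊗ P n ⊗ R n ⊗ I n

term-cong : ∀ n {M M' Y Y'} → M ≈S M' → Y ≈S Y' → term n M Y ≈S term n M' Y'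
term-cong n M≈M' Y≈Y' = S.*-congʳ (S.*-congʳ (S.*-congʳ (S.*-congʳ (S.*-cong (S.*-congˡ M≈M') Y≈Y'))))

term-xOrder : ∀ n e l Y → n ≤ e → OrderAtLeast xDegree n (term n (mono 0 e l) Y)
term-xOrder n e l Y n≤e =
  ⊗ˡ (⊗ˡ (⊗ˡ (⊗ˡ (⊗ˡ (order-⊗ʳ xDegree-superadditive n (A n) _
    (order-weaken xDegree e n _ n≤e (mono-xOrder 0 e l)))))))
  where
  ⊗ˡ : ∀ {f g} → OrderAtLeast xDegree n f → OrderAtLeast xDegree n (f ⊗ g)
  ⊗ˡ = order-⊗ˡ xDegree-superadditive n _ _

summand : ℕ → ℕ → ℕ → Series
summand k i n = term n (mono 0 ((k ∸ 1) *ℕ n) (qExp k i n)) (1S ⊝ mono 0 i (2 *ℕ n *ℕ i))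

Hterm≈summand : ∀ k i n → Hterm k i n ≈S summand k i n
Hterm≈summand k i n =
  *S≈⊗ (*S≈⊗ (*S≈⊗ (*S≈⊗ (*S≈⊗ (*S≈⊗ aPart≈A S.refl) (-S≈⊝ S.refl S.refl))
    poch≈X) pochInf≈P) invPochQ2≈R) invPochInf≈I
  where
  -a : -S aS ≈S ⊖ aS
  -a = -S≈⊖ S.refl
  aPart≈A : aPart n ≈S A n
  aPart≈A = Π<≈∏< n (λ m → -S≈⊝ -a (^S≈^ qS m))
  poch≈X : poch (-S xS) qS n ≈S X n
  poch≈X = Π<≈∏< n (λ m → -S≈⊝ S.refl (*S≈⊗ (-S≈⊖ S.refl) (^S≈^ qS m)))
  invPochQ2≈R : invPochQ2 n ≈S R n
  invPochQ2≈R = Π<≈∏< n (λ m → geomInv-cong (^S≈^ qS (2 +ℕ 2 *ℕ m)))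
  pochInf≈P : pochInf (-S aS *S xS *S (qS ^S suc n)) ≈S P n
  pochInf≈P = mkS λ d e l → coeff (Π<≈∏< (suc l) (λ m →
    -S≈⊝ S.refl (*S≈⊗ (*S≈⊗ (*S≈⊗ -a S.refl) (^S≈^ qS (suc n))) (^S≈^ qS m)))) d e l
  invPochInf≈I : invPochInf (xS *S (qS ^S n)) ≈S I n
  invPochInf≈I = mkS λ d e l → coeff (Π<≈∏< (suc l) (λ m →
    geomInv-cong (*S≈⊗ (*S≈⊗ S.refl (^S≈^ qS n)) (^S≈^ qS m)))) d e l

summand-xOrder : ∀ j i n → OrderAtLeast xDegree n (summand (2 +ℕ j) i n)
summand-xOrder j i n = term-xOrder n (suc j *ℕ n) (qExp (2 +ℕ j) i n) _ (ℕ.m≤m+n n (j *ℕ n))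

H̃≈sumTo : ∀ j i N → AgreeBelow xDegree (suc N) (H̃ (2 +ℕ j) i) (sumTo N (summand (2 +ℕ j) i))
H̃≈sumTo j i N d e l e<1+N =
  trans (Σ≤-cong e (λ n _ → coeff (Hterm≈summand (2 +ℕ j) i n) d e l))
    (Σ≤weight≈sumTo xDegree (summand (2 +ℕ j) i) N (summand-xOrder j i) d e l e<1+N)

module _ where
  open Data.Nat using (_+_; _*_)

  suc-C2 : ∀ n → suc n C 2 ≡ n + n C 2
  suc-C2 n = trans (sym (nCk+nC[k+1]≡[n+1]C[k+1] n 1)) (cong (_+ n C 2) (nC1≡n n))

  qExp-exact : ∀ j n → n C 2 + (3 + j) * n ≤ (2 + j) * n * n + n
  qExp-exact j zero    = ℕ.≤-reflexive (solveℕ 1 (λ j → (conℕ 3 :+ℕ j) :*ℕ conℕ 0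
                                                :=ℕ (conℕ 2 :+ℕ j) :*ℕ conℕ 0 :*ℕ conℕ 0 :+ℕ conℕ 0) refl j)
  qExp-exact j (suc n) = begin
    suc n C 2 + (3 + j) * suc n                        ≡⟨ cong (_+ (3 + j) * suc n) (suc-C2 n) ⟩
    (n + n C 2) + (3 + j) * suc n                      ≡⟨ regroup (n C 2) j n ⟩
    (n C 2 + (3 + j) * n) + (n + (3 + j))              ≤⟨ ℕ.+-mono-≤ (qExp-exact j n)
                                                            (ℕ.+-monoˡ-≤ (3 + j) (ℕ.m≤n*m n (4 + (j + j)))) ⟩
    ((2 + j) * n * n + n) + ((4 + (j + j)) * n + (3 + j))  ≡⟨ expand j n ⟩
    (2 + j) * suc n * suc n + suc n                    ∎
    where
    open ℕ.≤-Reasoning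
    regroup : ∀ B j n → (n + B) + (3 + j) * suc n ≡ (B + (3 + j) * n) + (n + (3 + j))
    regroup = solveℕ 3 (λ B j n → (n :+ℕ B) :+ℕ (conℕ 3 :+ℕ j) :*ℕ (conℕ 1 :+ℕ n)
                               :=ℕ (B :+ℕ (conℕ 3 :+ℕ j) :*ℕ n) :+ℕ (n :+ℕ (conℕ 3 :+ℕ j))) refl
    expand : ∀ j n → ((2 + j) * n * n + n) + ((4 + (j + j)) * n + (3 + j)) ≡ (2 + j) * suc n * suc n + suc n
    expand = solveℕ 2 (λ j n → ((conℕ 2 :+ℕ j) :*ℕ n :*ℕ n :+ℕ n) :+ℕ ((conℕ 4 :+ℕ (j :+ℕ j)) :*ℕ n :+ℕ (conℕ 3 :+ℕ j))
                             :=ℕ (conℕ 2 :+ℕ j) :*ℕ (conℕ 1 :+ℕ n) :*ℕ (conℕ 1 :+ℕ n) :+ℕ (conℕ 1 :+ℕ n)) refl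

  qExp-pred : ∀ j i n → i ≤ 2 + j → qExp (2 + j) i n ≡ qExp (2 + j) (suc i) n + n
  qExp-pred j i n i≤k = begin
    lead ∸ (binom + i * n)                ≡⟨ ℕ.m∸n+n≡m n≤rest ⟨
    (lead ∸ (binom + i * n) ∸ n) + n      ≡⟨ cong (_+ n) (ℕ.∸-+-assoc lead (binom + i * n) n) ⟩
    (lead ∸ ((binom + i * n) + n)) + n    ≡⟨ cong (λ u → (lead ∸ u) + n) shift ⟩
    (lead ∸ (binom + suc i * n)) + n      ∎
    where
    open ≡.≡-Reasoning
    lead binom : ℕ
    lead = (2 + j) * n * n + n
    binom = n C 2
    shift : (binom + i * n) + n ≡ binom + suc i * n
    shift = solveℕ 3 (λ c i n → (c :+ℕ i :*ℕ n) :+ℕ n :=ℕ c :+ℕ (conℕ 1 :+ℕ i) :*ℕ n) refl binom i n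
    bound : binom + suc i * n ≤ lead
    bound = ℕ.≤-trans (ℕ.+-monoʳ-≤ binom (ℕ.*-monoˡ-≤ n (s≤s i≤k))) (qExp-exact j n)
    n≤rest : n ≤ lead ∸ (binom + i * n)
    n≤rest = ℕ.m+n≤o⇒m≤o∸n n (ℕ.≤-trans (ℕ.≤-reflexive (trans (ℕ.+-comm n _) shift)) bound)

  wExp : ℕ → ℕ → ℕ
  wExp j n = qExp (2 + j) (3 + j) n

  wExp-suc : ∀ j n → wExp j (suc n) ≡ wExp j n + (2 * n * j + (n + (n + n)))
  wExp-suc j n = ℕ.+-cancelʳ-≡ (suc n C 2 + (3 + j) * suc n) _ _ (trans (complement (suc n)) (sym (begin
      (wExp j n + D) + (suc n C 2 + (3 + j) * suc n)
    ≡⟨ cong (λ c → (wExp j n + D) + (c + (3 + j) * suc n)) (suc-C2 n) ⟩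
      (wExp j n + D) + ((n + n C 2) + (3 + j) * suc n)
    ≡⟨ regroup (wExp j n) (n C 2) j n ⟩
      (wExp j n + (n C 2 + (3 + j) * n)) + (D + n + (3 + j))
    ≡⟨ cong (_+ (D + n + (3 + j))) (complement n) ⟩
      ((2 + j) * n * n + n) + (D + n + (3 + j))
    ≡⟨ expand j n ⟩
      (2 + j) * suc n * suc n + suc n
    ∎)))
    where
    open ≡.≡-Reasoning
    D : ℕ
    D = 2 * n * j + (n + (n + n))
    complement : ∀ m → wExp j m + (m C 2 + (3 + j) * m) ≡ (2 + j) * m * m + m
    complement m = ℕ.m∸n+n≡m (qExp-exact j m)
    regroup : ∀ w c j n → (w + (2 * n * j + (n + (n + n)))) + ((n + c) + (3 + j) * suc n)
                        ≡ (w + (c + (3 + j) * n)) + ((2 * n * j + (n + (n + n))) + n + (3 + j))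
    regroup = solveℕ 4 (λ w c j n →
      (w :+ℕ (conℕ 2 :*ℕ n :*ℕ j :+ℕ (n :+ℕ (n :+ℕ n)))) :+ℕ ((n :+ℕ c) :+ℕ (conℕ 3 :+ℕ j) :*ℕ (conℕ 1 :+ℕ n))
      :=ℕ (w :+ℕ (c :+ℕ (conℕ 3 :+ℕ j) :*ℕ n)) :+ℕ ((conℕ 2 :*ℕ n :*ℕ j :+ℕ (n :+ℕ (n :+ℕ n))) :+ℕ n :+ℕ (conℕ 3 :+ℕ j))) refl
    expand : ∀ j n → ((2 + j) * n * n + n) + ((2 * n * j + (n + (n + n))) + n + (3 + j))
                   ≡ (2 + j) * suc n * suc n + suc n
    expand = solveℕ 2 (λ j n →
      ((conℕ 2 :+ℕ j) :*ℕ n :*ℕ n :+ℕ n) :+ℕ ((conℕ 2 :*ℕ n :*ℕ j :+ℕ (n :+ℕ (n :+ℕ n))) :+ℕ n :+ℕ (conℕ 3 :+ℕ j))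
      :=ℕ (conℕ 2 :+ℕ j) :*ℕ (conℕ 1 :+ℕ n) :*ℕ (conℕ 1 :+ℕ n) :+ℕ (conℕ 1 :+ℕ n)) refl

one-minus-tendsToOne : ∀ c → TendsToOne (λ m → 1S ⊝ c ⊗ qS ^ m)
one-minus-tendsToOne c m d e l l<m = trans (⊕-coeff 1S _ d e l)
  (trans (cong (1S d e l +ℤ_) (trans (⊖-coeff _ d e l)
    (cong -ℤ_ (order-⊗ʳ qDegree-superadditive m c (qS ^ m)
      (order-^ qDegree-superadditive qS qS-qOrder m) d e l l<m))))
  (ℤ.+-identityʳ _))

P-unfold : ∀ n → P n ≈S (1S ⊝ (⊖ aS ⊗ xS) ⊗ qS ^ suc n) ⊗ P (suc n)
P-unfold n = S.trans (∏∞-unfoldˡ _ (one-minus-tendsToOne ((⊖ aS ⊗ xS) ⊗ qS ^ suc n)))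
  (S.*-cong (S.+-congˡ (S.-‿cong (S.*-identityʳ _))) (∏∞-cong λ m → S.+-congˡ (S.-‿cong
    (solve 4 (λ ax q Q Qₘ → (ax :* (q :* Q)) :* (q :* Qₘ) := (ax :* (q :* (q :* Q))) :* Qₘ)
       S.refl (⊖ aS ⊗ xS) qS (qS ^ n) (qS ^ m)))))

I-unfold : ∀ n → (1S ⊝ xS ⊗ qS ^ n) ⊗ I n ≈S I (suc n)
I-unfold n = begin
    (1S ⊝ xQ) ⊗ I n
  ≈⟨ S.*-congˡ (∏∞-unfoldˡ _ factors→1) ⟩
    (1S ⊝ xQ) ⊗ (geomInv (xQ ⊗ 1S) ⊗ ∏∞ (λ m → geomInv (xQ ⊗ (qS ⊗ qS ^ m))))
  ≈⟨ S.*-assoc _ _ _ ⟨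
    ((1S ⊝ xQ) ⊗ geomInv (xQ ⊗ 1S)) ⊗ ∏∞ (λ m → geomInv (xQ ⊗ (qS ⊗ qS ^ m)))
  ≈⟨ S.*-congʳ (S.trans (S.*-comm _ _)
       (S.trans (S.*-congʳ (geomInv-cong (S.*-identityʳ _))) (geomInv-inverse xQ xQ-order))) ⟩
    1S ⊗ ∏∞ (λ m → geomInv (xQ ⊗ (qS ⊗ qS ^ m)))
  ≈⟨ S.*-identityˡ _ ⟩
    ∏∞ (λ m → geomInv (xQ ⊗ (qS ⊗ qS ^ m)))
  ≈⟨ ∏∞-cong (λ m → geomInv-cong
       (solve 4 (λ x q Q Qₘ → (x :* Q) :* (q :* Qₘ) := (x :* (q :* Q)) :* Qₘ) S.refl xS qS (qS ^ n) (qS ^ m))) ⟩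
    I (suc n)
  ∎
  where
  open ≈S-Reasoning
  xQ : Series
  xQ = xS ⊗ qS ^ n
  xQ-order : OrderAtLeast xqDegree 1 xQ
  xQ-order = order-⊗ˡ xqDegree-superadditive 1 xS _ xS-xqOrder
  factors→1 : TendsToOne (λ m → geomInv (xQ ⊗ qS ^ m))
  factors→1 m = geomInv-tendsToOne _ m (order-⊗ʳ qDegree-superadditive m xQ (qS ^ m)
    (order-^ qDegree-superadditive qS qS-qOrder m))

R-step-inverse : ∀ n → geomInv (qS ^ (2 +ℕ 2 *ℕ n)) ⊗ (1S ⊝ qS ^ suc n ⊗ qS ^ suc n) ≈S 1S
R-step-inverse n = S.trans (S.*-congˡ (S.+-congˡ (S.-‿cong q²Q²≈)))
  (geomInv-inverse (qS ^ (2 +ℕ 2 *ℕ n)) (order-⊗ˡ xqDegree-superadditive 1 qS _ qS-xqOrder))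
  where
  q²Q²≈ : qS ^ suc n ⊗ qS ^ suc n ≈S qS ^ (2 +ℕ 2 *ℕ n)
  q²Q²≈ = S.trans (S.sym (^-+ qS (suc n) (suc n)))
    (S.reflexive (cong (qS ^_)
      (solveℕ 1 (λ n → (conℕ 1 :+ℕ n) :+ℕ (conℕ 1 :+ℕ n) :=ℕ conℕ 2 :+ℕ conℕ 2 :*ℕ n) refl n)))

-- The telescoping series

mono-xq : ∀ e l → mono 0 e l ≈S xS ^ e ⊗ qS ^ l
mono-xq e l = S.trans (mono≈powers 0 e l) (S.*-identityˡ _)

mono-q+ : ∀ e l s → mono 0 e (l +ℕ s) ≈S mono 0 e l ⊗ qS ^ s
mono-q+ e l s = S.sym (S.trans (S.*-congˡ (S.sym (S.trans (mono-xq 0 s) (S.*-identityˡ _))))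
  (S.trans (mono-⊗ 0 e l 0 0 s) (S.reflexive (cong (λ u → mono 0 u (l +ℕ s)) (ℕ.+-identityʳ e)))))

-- With k = 2 + j, W j n is the term
-- (-a)^n (-1/a;q)_n x^{(k-1)n} q^{kn²-C(n,2)-kn} (1 - q^{2n}) (1 + axq^n) (-x;q)_n
--   (-axq^{n+1};q)_∞ / ((q²;q²)_n (xq^n;q)_∞).
W : ℕ → ℕ → Series
W j n = term n (mono 0 (suc j *ℕ n) (wExp j n)) ((1S ⊝ qS ^ n ⊗ qS ^ n) ⊗ (1S ⊕ aS ⊗ xS ⊗ qS ^ n))

W-zero : ∀ j → W j 0 ≈S 0S
W-zero j = solve 8 (λ A M a x X P R I →
    A :* M :* ((con (+ 1) :- con (+ 1) :* con (+ 1)) :* (con (+ 1) :+ a :* x :* con (+ 1))) :* X :* P :* R :* I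
    := con (+ 0))
  S.refl (A 0) (mono 0 (suc j *ℕ 0) (wExp j 0)) aS xS (X 0) (P 0) (R 0) (I 0)

W-xOrder : ∀ j n → OrderAtLeast xDegree n (W j n)
W-xOrder j n = term-xOrder n (suc j *ℕ n) (wExp j n) _ (ℕ.m≤m+n n (j *ℕ n))

Δ : ℕ → ℕ → Series
Δ j n = (summand (2 +ℕ j) (3 +ℕ j) n ⊕ (aS ⊗ xS) ⊗ summand (2 +ℕ j) (2 +ℕ j) n)
      ⊝ (summand (2 +ℕ j) (1 +ℕ j) n ⊕ (aS ⊗ xS) ⊗ summand (2 +ℕ j) j n)

module Telescoping (j n : ℕ) where

  K : ℕ
  K = suc j *ℕ n

  Q M Z : Series
  Q = qS ^ n
  M = mono 0 K (wExp j n)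
  Z = mono 0 j (2 *ℕ n *ℕ j)

  mono-qExp-pred : ∀ i → i ≤ 2 +ℕ j →
    mono 0 K (qExp (2 +ℕ j) i n) ≈S mono 0 K (qExp (2 +ℕ j) (suc i) n) ⊗ Q
  mono-qExp-pred i i≤k =
    S.trans (S.reflexive (cong (mono 0 K) (qExp-pred j i n i≤k))) (mono-q+ K (qExp (2 +ℕ j) (suc i) n) n)

  mono-2ni : ∀ t → mono 0 (t +ℕ j) (2 *ℕ n *ℕ (t +ℕ j)) ≈S (xS ^ t ⊗ (Q ⊗ Q) ^ t) ⊗ Z
  mono-2ni t = begin
      mono 0 (t +ℕ j) (2 *ℕ n *ℕ (t +ℕ j))
    ≈⟨ S.reflexive (cong (mono 0 (t +ℕ j)) (solveℕ 3 (λ n t j →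
         conℕ 2 :*ℕ n :*ℕ (t :+ℕ j) :=ℕ t :*ℕ (n :+ℕ n) :+ℕ conℕ 2 :*ℕ n :*ℕ j) refl n t j)) ⟩
      mono 0 (t +ℕ j) (t *ℕ (n +ℕ n) +ℕ 2 *ℕ n *ℕ j)
    ≈⟨ mono-⊗ 0 t (t *ℕ (n +ℕ n)) 0 j (2 *ℕ n *ℕ j) ⟨
      mono 0 t (t *ℕ (n +ℕ n)) ⊗ Z
    ≈⟨ S.*-congʳ (S.trans (mono-xq t (t *ℕ (n +ℕ n))) (S.*-congˡ (S.trans (^-* qS t (n +ℕ n)) (^-cong t (^-+ qS n n))))) ⟩
      (xS ^ t ⊗ (Q ⊗ Q) ^ t) ⊗ Z
    ∎
    where open ≈S-Reasoning

  remainder : Series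
  remainder = A n ⊗ M ⊗ Z ⊗ xS ⊗ (Q ⊗ Q ⊗ Q) ⊗ (1S ⊝ xS ⊗ Q) ⊗ (1S ⊕ xS ⊗ Q) ⊗ (aS ⊕ Q)
    ⊗ X n ⊗ P n ⊗ R n ⊗ I n

  Δ-expanded : Δ j n ≈S W j n ⊕ remainder
  Δ-expanded = begin
      Δ j n
    ≈⟨ S.+-cong (S.+-cong (term-cong n S.refl (S.+-congˡ (S.-‿cong (mono-2ni 3))))
                          (S.*-congˡ (term-cong n M₂ (S.+-congˡ (S.-‿cong (mono-2ni 2))))))
                (S.-‿cong (S.+-cong (term-cong n M₁ (S.+-congˡ (S.-‿cong (mono-2ni 1))))
                                    (S.*-congˡ (term-cong n M₀ (S.+-congˡ (S.-‿cong (mono-2ni 0))))))) ⟩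
      (term n M (1S ⊝ Y 3) ⊕ (aS ⊗ xS) ⊗ term n (M ⊗ Q) (1S ⊝ Y 2))
        ⊝ (term n (M ⊗ Q ⊗ Q) (1S ⊝ Y 1) ⊕ (aS ⊗ xS) ⊗ term n (M ⊗ Q ⊗ Q ⊗ Q) (1S ⊝ Y 0))
    ≈⟨ solve 10 (λ A M Z x Q a X P R I →
         let o = con (+ 1)
             T = λ Mᵢ Yᵢ → A :* Mᵢ :* (o :- Yᵢ :* Z) :* X :* P :* R :* I
             QQ = Q :* Q
         in (T M (x :* (x :* (x :* o)) :* (QQ :* (QQ :* (QQ :* o))))
               :+ (a :* x) :* T (M :* Q) (x :* (x :* o) :* (QQ :* (QQ :* o))))
            :- (T (M :* Q :* Q) (x :* o :* (QQ :* o)) :+ (a :* x) :* T (M :* Q :* Q :* Q) (o :* o))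
            := A :* M :* ((o :- Q :* Q) :* (o :+ a :* x :* Q)) :* X :* P :* R :* I
               :+ A :* M :* Z :* x :* (Q :* Q :* Q) :* (o :- x :* Q) :* (o :+ x :* Q) :* (a :+ Q) :* X :* P :* R :* I)
         S.refl (A n) M Z xS Q aS (X n) (P n) (R n) (I n) ⟩
      W j n ⊕ remainder
    ∎
    where
    open ≈S-Reasoning
    Y : ℕ → Series
    Y t = (xS ^ t ⊗ (Q ⊗ Q) ^ t) ⊗ Z
    M₂ : mono 0 K (qExp (2 +ℕ j) (2 +ℕ j) n) ≈S M ⊗ Q
    M₂ = mono-qExp-pred (2 +ℕ j) ℕ.≤-refl
    M₁ : mono 0 K (qExp (2 +ℕ j) (1 +ℕ j) n) ≈S M ⊗ Q ⊗ Q
    M₁ = S.trans (mono-qExp-pred (1 +ℕ j) (ℕ.n≤1+n _)) (S.*-congʳ M₂)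
    M₀ : mono 0 K (qExp (2 +ℕ j) j n) ≈S M ⊗ Q ⊗ Q ⊗ Q
    M₀ = S.trans (mono-qExp-pred j (ℕ.m≤n+m j 2)) (S.*-congʳ M₁)

  M-suc : mono 0 (suc j *ℕ suc n) (wExp j (suc n)) ≈S M ⊗ (Z ⊗ (xS ⊗ (Q ⊗ (Q ⊗ Q))))
  M-suc = begin
      mono 0 (suc j *ℕ suc n) (wExp j (suc n))
    ≈⟨ S.reflexive (cong₂ (mono 0) x-exponent (wExp-suc j n)) ⟩
      mono 0 (K +ℕ (j +ℕ 1)) (wExp j n +ℕ (2 *ℕ n *ℕ j +ℕ (n +ℕ (n +ℕ n))))
    ≈⟨ mono-⊗ 0 K (wExp j n) 0 (j +ℕ 1) _ ⟨
      M ⊗ mono 0 (j +ℕ 1) (2 *ℕ n *ℕ j +ℕ (n +ℕ (n +ℕ n)))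
    ≈⟨ S.*-congˡ (mono-⊗ 0 j (2 *ℕ n *ℕ j) 0 1 (n +ℕ (n +ℕ n))) ⟨
      M ⊗ (Z ⊗ mono 0 1 (n +ℕ (n +ℕ n)))
    ≈⟨ S.*-congˡ (S.*-congˡ (S.trans (mono-xq 1 (n +ℕ (n +ℕ n))) (S.*-cong (S.*-identityʳ xS)
         (S.trans (^-+ qS n (n +ℕ n)) (S.*-congˡ (^-+ qS n n)))))) ⟩
      M ⊗ (Z ⊗ (xS ⊗ (Q ⊗ (Q ⊗ Q))))
    ∎
    where
    open ≈S-Reasoning
    x-exponent : suc j *ℕ suc n ≡ K +ℕ (j +ℕ 1)
    x-exponent = solveℕ 2 (λ j n → (conℕ 1 :+ℕ j) :*ℕ (conℕ 1 :+ℕ n)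
                                   :=ℕ (conℕ 1 :+ℕ j) :*ℕ n :+ℕ (j :+ℕ conℕ 1)) refl j n

  -- In W j (suc n), the factor 1 + axq^{n+1} merges P (suc n) into P n, and
  -- 1 - q^{2n+2} cancels the last factor of R (suc n).
  W-suc : W j (suc n) ≈S ⊖ remainder
  W-suc = begin
      W j (suc n)
    ≈⟨ term-cong (suc n) M-suc S.refl ⟩
      A (suc n) ⊗ (M ⊗ (Z ⊗ (xS ⊗ Q³))) ⊗ ((1S ⊝ qQ ⊗ qQ) ⊗ (1S ⊕ aS ⊗ xS ⊗ qQ))
        ⊗ X (suc n) ⊗ P (suc n) ⊗ (R n ⊗ G) ⊗ I (suc n)
    ≈⟨ S.*-congˡ (I-unfold n) ⟨
      A (suc n) ⊗ (M ⊗ (Z ⊗ (xS ⊗ Q³))) ⊗ ((1S ⊝ qQ ⊗ qQ) ⊗ (1S ⊕ aS ⊗ xS ⊗ qQ))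
        ⊗ X (suc n) ⊗ P (suc n) ⊗ (R n ⊗ G) ⊗ ((1S ⊝ xS ⊗ Q) ⊗ I n)
    ≈⟨ solve 12 (λ A M Z x Q a X P′ R G I q →
         let o = con (+ 1) in
           A :* (:- a :- Q) :* (M :* (Z :* (x :* (Q :* (Q :* Q))))) :* ((o :- (q :* Q) :* (q :* Q)) :* (o :+ a :* x :* (q :* Q)))
             :* (X :* (o :- :- x :* Q)) :* P′ :* (R :* G) :* ((o :- x :* Q) :* I)
         := Ψ′ A M Z x Q a X R I :* ((o :- (:- a :* x) :* (q :* Q)) :* P′) :* (G :* (o :- (q :* Q) :* (q :* Q))))
         S.refl (A n) M Z xS Q aS (X n) (P (suc n)) (R n) G (I n) qS ⟩
      Ψ ⊗ ((1S ⊝ (⊖ aS ⊗ xS) ⊗ qQ) ⊗ P (suc n)) ⊗ (G ⊗ (1S ⊝ qQ ⊗ qQ))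
    ≈⟨ S.*-cong (S.*-congˡ (P-unfold n)) (S.sym (R-step-inverse n)) ⟨
      Ψ ⊗ P n ⊗ 1S
    ≈⟨ solve 10 (λ A M Z x Q a X P R I → Ψ′ A M Z x Q a X R I :* P :* con (+ 1) := :- (A :* M :* Z :* x :* (Q :* Q :* Q)
         :* (con (+ 1) :- x :* Q) :* (con (+ 1) :+ x :* Q) :* (a :+ Q) :* X :* P :* R :* I))
         S.refl (A n) M Z xS Q aS (X n) (P n) (R n) (I n) ⟩
      ⊖ remainder
    ∎
    where
    open ≈S-Reasoning
    Q³ qQ G Ψ : Series
    Q³ = Q ⊗ (Q ⊗ Q)
    qQ = qS ⊗ Q
    G = geomInv (qS ^ (2 +ℕ 2 *ℕ n))
    Ψ′ : ∀ {m} → (A M Z x Q a X R I : Solver.Polynomial m) → Solver.Polynomial m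
    Ψ′ A M Z x Q a X R I =
      A :* (:- a :- Q) :* M :* Z :* x :* (Q :* (Q :* Q)) :* X :* (con (+ 1) :+ x :* Q) :* R :* (con (+ 1) :- x :* Q) :* I
    Ψ = A n ⊗ (⊖ aS ⊝ Q) ⊗ M ⊗ Z ⊗ xS ⊗ Q³ ⊗ X n ⊗ (1S ⊕ xS ⊗ Q) ⊗ R n ⊗ (1S ⊝ xS ⊗ Q) ⊗ I n

Δ-telescopes : ∀ j n → Δ j n ≈S W j n ⊝ W j (suc n)
Δ-telescopes j n = S.trans Δ-expanded (S.+-congˡ
  (S.trans (solve 1 (λ v → v := :- (:- v)) S.refl remainder) (S.-‿cong (S.sym W-suc))))
  where open Telescoping j n

sumTo-combination : ∀ N (F G F' G' : ℕ → Series) c →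
  (sumTo N F ⊕ c ⊗ sumTo N G) ⊝ (sumTo N F' ⊕ c ⊗ sumTo N G')
    ≈S sumTo N (λ n → (F n ⊕ c ⊗ G n) ⊝ (F' n ⊕ c ⊗ G' n))
sumTo-combination zero    F G F' G' c = S.refl
sumTo-combination (suc N) F G F' G' c = S.trans
  (solve 9 (λ s t s' t' f g f' g' c → ((s :+ f) :+ c :* (t :+ g)) :- ((s' :+ f') :+ c :* (t' :+ g'))
                                 := ((s :+ c :* t) :- (s' :+ c :* t')) :+ ((f :+ c :* g) :- (f' :+ c :* g')))
     S.refl (sumTo N F) (sumTo N G) (sumTo N F') (sumTo N G') (F (suc N)) (G (suc N)) (F' (suc N)) (G' (suc N)) c)
  (S.+-congʳ (sumTo-combination N F G F' G' c))

sumTo-telescope : ∀ N (V T : ℕ → Series) → (∀ n → T n ≈S V n ⊝ V (suc n)) → sumTo N T ≈S V 0 ⊝ V (suc N)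
sumTo-telescope zero    V T T≈ΔV = T≈ΔV 0
sumTo-telescope (suc N) V T T≈ΔV = S.trans (S.+-cong (sumTo-telescope N V T T≈ΔV) (T≈ΔV (suc N)))
  (solve 3 (λ a b c → (a :- b) :+ (b :- c) := a :- c) S.refl (V 0) (V (suc N)) (V (suc (suc N))))

Φ : ℕ → ℕ → Series
Φ k i = H̃ k i ⊕ (aS ⊗ xS) ⊗ H̃ k (i ∸ 1)

Φ-difference≈sumTo : ∀ j N → AgreeBelow xDegree (suc N)
  (Φ (2 +ℕ j) (3 +ℕ j) ⊝ Φ (2 +ℕ j) (1 +ℕ j)) (sumTo N (Δ j))
Φ-difference≈sumTo j N = agree-trans xDegree (suc N)
  (agree-⊕ xDegree (suc N) (agree-⊕ xDegree (suc N) (H̃≈sumTo j (3 +ℕ j) N) (ax⊗ (H̃≈sumTo j (2 +ℕ j) N)))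
    (agree-⊖ xDegree (suc N) (agree-⊕ xDegree (suc N) (H̃≈sumTo j (1 +ℕ j) N) (ax⊗ (H̃≈sumTo j j N)))))
  (≈S⇒agree xDegree (suc N) (sumTo-combination N _ _ _ _ (aS ⊗ xS)))
  where
  ax⊗ : ∀ {f g} → AgreeBelow xDegree (suc N) f g → AgreeBelow xDegree (suc N) ((aS ⊗ xS) ⊗ f) ((aS ⊗ xS) ⊗ g)
  ax⊗ = agree-⊗ xDegree-superadditive (suc N) _ _ _ _ (agree-refl xDegree (suc N) (aS ⊗ xS))

Φ-top≈Φ-bottom : ∀ j → Φ (2 +ℕ j) (3 +ℕ j) ≈S Φ (2 +ℕ j) (1 +ℕ j)
Φ-top≈Φ-bottom j = x∙y⁻¹≈ε⇒x≈y _ _ (mkS λ d e l → begin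
    (Φ (2 +ℕ j) (3 +ℕ j) ⊝ Φ (2 +ℕ j) (1 +ℕ j)) d e l
  ≡⟨ Φ-difference≈sumTo j e d e l (ℕ.n<1+n e) ⟩
    sumTo e (Δ j) d e l
  ≡⟨ coeff (sumTo-telescope e (W j) (Δ j) (Δ-telescopes j)) d e l ⟩
    (W j 0 ⊝ W j (suc e)) d e l
  ≡⟨ ⊕-coeff (W j 0) _ d e l ⟩
    W j 0 d e l +ℤ (⊖ W j (suc e)) d e l
  ≡⟨ cong₂ _+ℤ_ (coeff (W-zero j) d e l)
       (trans (⊖-coeff _ d e l) (cong -ℤ_ (W-xOrder j (suc e) d e l (ℕ.n<1+n e)))) ⟩
    0ℤ ∎)
  where
  open ≡.≡-Reasoning
  open GroupProperties S.+-group using (x∙y⁻¹≈ε⇒x≈y)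

substXq-cong : ∀ {f g} → f ≈S g → substXq f ≈S substXq g
substXq-cong {f} {g} f≈g = mkS substituted
  where
  substituted : ∀ d e l → substXq f d e l ≡ substXq g d e l
  substituted d e l with e ≤ᵇ l
  ... | true  = coeff f≈g d e (l ∸ e)
  ... | false = refl

substXq-+S : ∀ f g → substXq f +S substXq g ≈S substXq (f ⊕ g)
substXq-+S f g = mkS substituted
  where
  substituted : ∀ d e l → substXq f d e l +ℤ substXq g d e l ≡ substXq (f ⊕ g) d e l
  substituted d e l with e ≤ᵇ l
  ... | true  = sym (⊕-coeff f g d e (l ∸ e))
  ... | false = refl

substXq-aS : ∀ f → substXq (aS ⊗ f) ≈S aS ⊗ substXq f
substXq-aS f = S.trans (substXq-cong (aS-⊗ f)) (S.trans (mkS substituted) (S.sym (aS-⊗ (substXq f))))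
  where
  substituted : ∀ d e l → substXq (aShift f) d e l ≡ aShift (substXq f) d e l
  substituted zero e l with e ≤ᵇ l
  ... | true  = refl
  ... | false = refl
  substituted (suc d) e l = refl

≤ᵇ-suc : ∀ e l → (suc e ≤ᵇ suc l) ≡ (e ≤ᵇ l)
≤ᵇ-suc zero    l = refl
≤ᵇ-suc (suc e) l = refl

substXq-xS : ∀ f → substXq (xS ⊗ f) ≈S xS ⊗ (qS ⊗ substXq f)
substXq-xS f = S.trans (substXq-cong (xS-⊗ f))
  (S.trans (mkS substituted) (S.sym (S.trans (xS-⊗ _) (mkS λ d e l → shift-q d e l))))
  where
  substituted : ∀ d e l → substXq (xShift f) d e l ≡ xShift (qShift (substXq f)) d e l
  substituted d zero    l       = refl
  substituted d (suc e) zero    = refl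
  substituted d (suc e) (suc l) rewrite ≤ᵇ-suc e l = refl
  shift-q : ∀ d e l → xShift (qS ⊗ substXq f) d e l ≡ xShift (qShift (substXq f)) d e l
  shift-q d zero    l = refl
  shift-q d (suc e) l = coeff (qS-⊗ (substXq f)) d e l

J̃≈substXq-Φ : ∀ k i → J̃ k i ≈S substXq (Φ k i)
J̃≈substXq-Φ k i = begin
    J̃ k i
  ≈⟨ +S-cong (S.refl {substXq (H̃ k i)}) axq⊗H ⟩
    substXq (H̃ k i) +S substXq ((aS ⊗ xS) ⊗ H̃ k (i ∸ 1))
  ≈⟨ substXq-+S _ _ ⟩
    substXq (Φ k i)
  ∎
  where
  open ≈S-Reasoning
  H : Series
  H = H̃ k (i ∸ 1)
  axq⊗H : mono 1 1 1 *S substXq H ≈S substXq ((aS ⊗ xS) ⊗ H)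
  axq⊗H = begin
      mono 1 1 1 *S substXq H
    ≈⟨ *S≈⊗ (mono≈powers 1 1 1) S.refl ⟩
      (aS ^ 1 ⊗ (xS ^ 1 ⊗ qS ^ 1)) ⊗ substXq H
    ≈⟨ solve 4 (λ a x q h → (a :* con (+ 1)) :* ((x :* con (+ 1)) :* (q :* con (+ 1))) :* h := a :* (x :* (q :* h)))
         S.refl aS xS qS (substXq H) ⟩
      aS ⊗ (xS ⊗ (qS ⊗ substXq H))
    ≈⟨ S.*-congˡ (substXq-xS H) ⟨
      aS ⊗ substXq (xS ⊗ H)
    ≈⟨ substXq-aS (xS ⊗ H) ⟨
      substXq (aS ⊗ (xS ⊗ H))
    ≈⟨ substXq-cong (S.*-assoc aS xS H) ⟨
      substXq ((aS ⊗ xS) ⊗ H)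
    ∎

mainTheorem9 : (k : ℕ) → 2 ≤ k → (d e l : ℕ) →
    J̃ k (suc k) d e l ≡ J̃ k (k ∸ 1) d e l
mainTheorem9 (suc (suc j)) (s≤s (s≤s z≤n)) = coeff (begin
  J̃ (2 +ℕ j) (3 +ℕ j)           ≈⟨ J̃≈substXq-Φ (2 +ℕ j) (3 +ℕ j) ⟩
  substXq (Φ (2 +ℕ j) (3 +ℕ j)) ≈⟨ substXq-cong (Φ-top≈Φ-bottom j) ⟩
  substXq (Φ (2 +ℕ j) (1 +ℕ j)) ≈⟨ J̃≈substXq-Φ (2 +ℕ j) (1 +ℕ j) ⟨
  J̃ (2 +ℕ j) (1 +ℕ j)           ∎)
  where open ≈S-Reasoning
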